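{- For every positive integer $d$, the polynomial $P_{2d+1,d}$ is not contained in $A_d(\mathcal{F}^d)$.
   Context: A region $\mathcal{R}$ is a simply connected planar region which is a finite union of closed unit squares with integer corners and which can be tiled by dominoes ($1\times2$ and $2\times1$). Its tilings by dominoes and $2\times2$ squares form a cubical complex $\mathcal{C}(\mathcal{R})$, a tiling with exactly $k$ squares being a $k$-dimensional face; with $f_k$ the number of such tilings, $F_{\mathcal{R}}(x)=\sum_kf_kx^k$ and $P_{\mathcal{R}}(x)=F_{\mathcal{R}}(x-1)$. $\mathcal{P}^d$ is the real vector space of polynomials of degree at most $d$, and $\mathcal{F}^d$ is the affine subspace of $\mathcal{P}^d$ spanned (affine hull) by all polynomials $P_{\mathcal{R}}$ of degree exactly $d$. $G_n$ is the ladder graph with vertices $(j,0),(j,1)$, $0\le j\le n$, horizontal edges $(j,a)(j+1,a)$ and vertical edges $(j,0)(j,1)$, whose elementary regions are $n$ unit squares (the $i$-th with corners in columns $i-1,i$); for $1\le i\le n$, $G_{n,i}$ is obtained by adding a unit square below the $i$-th square. For such a graph $G$, tilings are partitions of the vertex set into edges and vertex sets of unit squares, forming a cubical complex $\mathcal{C}(G)$ with a tiling using $k$ squares being a $k$-face; $P_n(x)=F_{G_n}(x-1)$ and $P_{n,i}(x)=F_{G_{n,i}}(x-1)$, where $F_G(x)=\sum_k f_k(\mathcal{C}(G))x^k$. (Equivalently $G_n$, $G_{n,i}$ correspond to the regions consisting of a $2\times(n+1)$ rectangle of unit cells, resp. that rectangle with two cells added below columns $i,i+1$.) Linear maps $A_d:\mathcal{P}^d\to\mathcal{P}^{d+1}$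 are defined recursively by $A_d(x^k)=xA_{d-1}(x^{k-1})$ for $k>0$, $A_0(1)=1+2x$, and $A_d(1)=P_{2d+1}-A_d(P_{2d-1}-1)$ for $d\ge1$.
   Formalization: Polynomials in $\mathcal{P}^d$ have rational coefficients and the affine combinations spanning $\mathcal{F}^d$ have rational weights, in place of real ones. -}

module Defs where

open import Data.Bool using (Bool; true; false; _∧_; if_then_else_)
open import Data.Nat as ℕ using (ℕ; zero; suc; _∸_; _≡ᵇ_; _≤ᵇ_)
open import Data.Nat.Combinatorics using (_C_)
open import Data.Integer as ℤ using (ℤ; +_; 1ℤ; -1ℤ)
open import Data.Rational as ℚ using (ℚ; 0ℚ; 1ℚ)
open import Data.Bool.ListAction using (any; all)
open import Data.List using (List; []; _∷_; map; length; _++_; concatMap; filterᵇ; foldr)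
open import Data.List.Membership.Propositional using (_∈_; _∉_)
open import Data.List.Relation.Unary.Unique.Propositional using (Unique)
open import Data.List.Relation.Unary.All using (All)
open import Data.Product using (_×_; _,_; proj₁; proj₂; Σ; ∃)
open import Relation.Nullary using (¬_)
open import Relation.Nullary.Decidable using (⌊_⌋)
open import Relation.Binary.PropositionalEquality using (_≡_; _≢_)

-- Cells of the plane: the closed unit square [a,a+1]×[b,b+1] is the cell (a , b).

Cell : Set
Cell = ℤ × ℤ

_==ᶜ_ : Cell → Cell → Bool
(a , b) ==ᶜ (c , d) = ⌊ a ℤ.≟ c ⌋ ∧ ⌊ b ℤ.≟ d ⌋

_∈ᵇ_ : Cell → List Cell → Bool
x ∈ᵇ xs = any (x ==ᶜ_) xs

countᵇ : {A : Set} → (A → Bool) → List A → ℕ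
countᵇ p xs = length (filterᵇ p xs)

data Shape : Set where
  horiz vert square : Shape

Tile : Set
Tile = Cell × Shape

tileCells : Tile → List Cell
tileCells ((a , b) , horiz)  = (a , b) ∷ (a ℤ.+ 1ℤ , b) ∷ []
tileCells ((a , b) , vert)   = (a , b) ∷ (a , b ℤ.+ 1ℤ) ∷ []
tileCells ((a , b) , square) =
  (a , b) ∷ (a ℤ.+ 1ℤ , b) ∷ (a , b ℤ.+ 1ℤ) ∷ (a ℤ.+ 1ℤ , b ℤ.+ 1ℤ) ∷ []

isSquare : Tile → Bool
isSquare (_ , square) = true
isSquare (_ , _)      = false

-- all tiles which could possibly occur in a tiling of R (lower-left cell in R)
candidates : List Cell → List Tile
candidates R = concatMap (λ c → (c , horiz) ∷ (c , vert) ∷ (c , square) ∷ []) R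

-- all sub-lists (= subsets, when the list is duplicate free)
sublists : {A : Set} → List A → List (List A)
sublists []       = [] ∷ []
sublists (x ∷ xs) = sublists xs ++ map (x ∷_) (sublists xs)

isTiling : List Cell → List Tile → Bool
isTiling R T =
  all (λ t → all (_∈ᵇ R) (tileCells t)) T ∧
  all (λ x → countᵇ (λ t → x ∈ᵇ tileCells t) T ≡ᵇ 1) R

-- f_k(R): number of tilings of R by dominoes and 2×2 squares with exactly
-- k squares (= number of k-faces of the cubical complex C(R)).
f : List Cell → ℕ → ℕ
f R k = countᵇ (λ T → isTiling R T ∧ (countᵇ isSquare T ≡ᵇ k)) (sublists (candidates R))

Poly : Set
Poly = ℕ → ℚ

sumBelow : ℕ → (ℕ → ℚ) → ℚ
sumBelow zero    g = 0ℚ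
sumBelow (suc n) g = sumBelow n g ℚ.+ g n

ℕtoℚ : ℕ → ℚ
ℕtoℚ n = (+ n) ℚ./ 1

ℤtoℚ : ℤ → ℚ
ℤtoℚ z = z ℚ./ 1

F : List Cell → Poly
F R k = ℕtoℚ (f R k)

-- P_R(x) = F_R(x - 1); coefficient of x^j is Σ_k f_k C(k,j) (-1)^(k-j).
-- (f_k = 0 for k > |R|, so the sum over k ≤ |R| is the full sum.)
P : List Cell → Poly
P R j = sumBelow (suc (length R))
          (λ k → ℤtoℚ ((+ (f R k ℕ.* (k C j))) ℤ.* (-1ℤ ℤ.^ (k ∸ j))))

HasDegree : Poly → ℕ → Set
HasDegree p d = (p d ≢ 0ℚ) × (∀ j → d ℕ.< j → p j ≡ 0ℚ)

-- closed cells meet (share a point) / open-square cells share an edge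
adj8 : Cell → Cell → Bool
adj8 (a , b) (c , d) = (ℤ.∣ a ℤ.- c ∣ ≤ᵇ 1) ∧ (ℤ.∣ b ℤ.- d ∣ ≤ᵇ 1)

adj4 : Cell → Cell → Bool
adj4 (a , b) (c , d) = (ℤ.∣ a ℤ.- c ∣ ℕ.+ ℤ.∣ b ℤ.- d ∣) ≤ᵇ 1

data Path (S : Cell → Set) (adj : Cell → Cell → Bool) : Cell → Cell → Set where
  stop : ∀ {x} → S x → Path S adj x x
  step : ∀ {x y z} → S x → adj x y ≡ true → Path S adj y z → Path S adj x z

-- The union of the closed cells of R is connected.
UnionConnected : List Cell → Set
UnionConnected R = ∀ x y → x ∈ R → y ∈ R → Path (_∈ R) adj8 x y

-- The complement ℝ² ∖ ⋃R is connected (its components are the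
-- 4-connected components of the non-cells).
ComplementConnected : List Cell → Set
ComplementConnected R = ∀ x y → x ∉ R → y ∉ R → Path (_∉ R) adj4 x y

-- a region: finite set of cells (duplicate-free list), whose union is
-- simply connected (= connected with connected complement, for such
-- polyhedral planar sets), and which can be tiled by dominoes.
IsRegion : List Cell → Set
IsRegion R = Unique R × UnionConnected R × ComplementConnected R × (0 ℕ.< f R 0)

rect : ℕ → List Cell
rect zero    = (+ 0 , + 0) ∷ (+ 0 , + 1) ∷ []
rect (suc n) = rect n ++ ((+ suc n , + 0) ∷ (+ suc n , + 1) ∷ [])

-- G_{n,i}: add the two cells below the i-th square (columns i-1, i)
ladder : ℕ → ℕ → List Cell
ladder n i = rect n ++ ((+ i ℤ.- 1ℤ , -1ℤ) ∷ (+ i , -1ℤ) ∷ [])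

Pn : ℕ → Poly
Pn n = P (rect n)

Pni : ℕ → ℕ → Poly
Pni n i = P (ladder n i)

xmul : Poly → Poly
xmul p zero    = 0ℚ
xmul p (suc j) = p j

-- img d k = A_d(x^k), for k ≤ d
img : ℕ → ℕ → Poly
img zero zero zero = 1ℚ
img zero zero (suc zero) = ℕtoℚ 2
img zero zero (suc (suc j)) = 0ℚ
img zero (suc k) j = 0ℚ   -- unused (k ≤ d)
img (suc d) (suc k) = xmul (img d k)
-- A_{d+1}(1) = P_{2d+3} - A_{d+1}(P_{2d+1} - 1),
-- and A_{d+1}(x^{k+1}) = x A_d(x^k)
img (suc d) zero j =
  Pn (suc (suc (suc (d ℕ.+ d)))) j ℚ.-
  sumBelow (suc d) (λ k → Pn (suc (d ℕ.+ d)) (suc k) ℚ.* xmul (img d k) j)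

-- A_d applied to (the degree ≤ d part of) p
A : ℕ → Poly → Poly
A d p j = sumBelow (suc d) (λ k → p k ℚ.* img d k j)

combo : List (ℚ × List Cell) → Poly
combo fam j = foldr (λ wR acc → proj₁ wR ℚ.* P (proj₂ wR) j ℚ.+ acc) 0ℚ fam

weightSum : List (ℚ × List Cell) → ℚ
weightSum fam = foldr (λ wR acc → proj₁ wR ℚ.+ acc) 0ℚ fam

InF : ℕ → Poly → Set
InF d q = Σ (List (ℚ × List Cell)) λ fam →
  All (λ wR → IsRegion (proj₂ wR) × HasDegree (P (proj₂ wR)) d) fam ×
  (weightSum fam ≡ 1ℚ) × (∀ j → q j ≡ combo fam j)

InAdF : ℕ → Poly → Set
InAdF d p = Σ Poly λ q → InF d q × (∀ j → A d q j ≡ p j)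

-- Let F₀ = 0, F₁ = 1, F_{k+2} = F_{k+1} + x F_k be the Fibonacci polynomials.  Counting tilings
-- column by column (a two-state transfer matrix) gives P_n = F_{n+2} and, for n = i + m,
-- P_{n,i} = F_{n+2} + x F_i F_{m+1}.  Let Γ = Σ γ_m x^m be the power series with [x^m](F_{m+2} Γ) = (-1)^m;
-- the recursion F_{n+4} = F_{n+3} + x F_{n+2} then gives [x^m](F_{n+2} Γ) = 0 whenever 1 ≤ m < n ≤ 2m.
-- The linear functional ϕ_d(p) = [x^{d+1}](p Γ) satisfies ϕ_{d+1}(x p) = ϕ_d(p), and ϕ_{d+1}(P_{2d+3}) = 0,
-- so by the recursive definition of A_d it vanishes on the image of A_d.  But
-- ϕ_d(P_{2d+1,d}) = [x^d](F_d · F_{d+2} Γ) = Σ_j [x^j]F_d · [x^{d-j}](F_{d+2} Γ) = (-1)^d: for j ≥ 1 either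
-- the first factor vanishes (deg F_d < d/2) or the second one does.
{-# OPTIONS --safe #-}
module Submission where

open import Defs
open import Algebra.Bundles using (CommutativeRing)
open import Data.Bool using (Bool; true; false; _∧_; _∨_; not; if_then_else_)
open import Data.Bool.Properties using (∧-zeroʳ; ¬-not)
open import Data.Bool.ListAction using (all)
open import Data.Empty using (⊥; ⊥-elim)
open import Data.Nat as ℕ using (ℕ; zero; suc; _≤_; _<_; z≤n; s≤s; _∸_; _≡ᵇ_)
import Data.Nat.Properties as ℕP
import Data.Nat.Tactic.RingSolver as ℕSolver
open import Data.Nat.Combinatorics using (_C_; nCk+nC[k+1]≡[n+1]C[k+1]; k>n⇒nCk≡0)
open import Data.Integer as ℤ using (ℤ; 0ℤ; 1ℤ; -1ℤ)
import Data.Integer.Properties as ℤP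
import Data.Integer.Tactic.RingSolver as ℤSolver
open import Data.Rational as ℚ using (ℚ; 0ℚ; toℚᵘ)
import Data.Rational.Properties as ℚP
open import Data.Rational.Unnormalised as ℚᵘ using (mkℚᵘ; *≡*)
import Data.Rational.Unnormalised.Properties as ℚᵘP
open import Data.List using (List; []; _∷_; map; length; _++_; filterᵇ; null)
open import Data.List.Properties using (length-++; filter-++)
open import Data.List.Membership.Propositional using (_∈_; _∉_)
open import Data.List.Membership.Propositional.Properties using (∈-++⁺ˡ; ∈-++⁺ʳ; ∈-++⁻)
open import Data.List.Relation.Unary.Any using (here; there)
open import Data.List.Relation.Unary.All as All using (All; []; _∷_)
open import Data.List.Relation.Unary.All.Properties using (++⁺)
open import Data.List.Relation.Binary.Permutation.Propositional as Perm using (_↭_)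
open import Data.List.Relation.Binary.Permutation.Propositional.Properties using (++-comm)
open import Data.Product using (Σ; _×_; _,_; proj₁)
open import Data.Sum using (_⊎_; inj₁; inj₂)
open import Function using (_∘_; case_of_)
open import Relation.Nullary using (¬_; yes; no)
open import Relation.Nullary.Decidable using (⌊_⌋; T?; does; dec-true; dec-false)
open import Relation.Binary.PropositionalEquality
  using (_≡_; _≢_; refl; sym; trans; cong; cong₂; subst; module ≡-Reasoning)

module Counting where

  open import Data.Nat using (_+_)

  ∧-trueˡ : ∀ {a b} → a ∧ b ≡ true → a ≡ true
  ∧-trueˡ {true} _ = refl

  ∧-trueʳ : ∀ {a b} → a ∧ b ≡ true → b ≡ true
  ∧-trueʳ {true} e = e

  bool-ext : ∀ {a b : Bool} → (a ≡ true → b ≡ true) → (b ≡ true → a ≡ true) → a ≡ b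
  bool-ext {false} {false} _ _ = refl
  bool-ext {false} {true}  _ g = g refl
  bool-ext {true}  {false} f _ = sym (f refl)
  bool-ext {true}  {true}  _ _ = refl

  ∧-interchange : ∀ a b c d → (a ∧ b) ∧ (c ∧ d) ≡ (a ∧ c) ∧ (b ∧ d)
  ∧-interchange false b c d = refl
  ∧-interchange true  b c d with b
  ... | false = sym (∧-zeroʳ c)
  ... | true  = refl

  ≟-sound : ∀ (a b : ℤ) → ⌊ a ℤ.≟ b ⌋ ≡ true → a ≡ b
  ≟-sound a b _ with a ℤ.≟ b
  ... | yes a≡b = a≡b

  ≟-refl : ∀ (a : ℤ) → ⌊ a ℤ.≟ a ⌋ ≡ true
  ≟-refl a with a ℤ.≟ a
  ... | yes _   = refl
  ... | no a≢a = ⊥-elim (a≢a refl)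

  ==ᶜ-sound : ∀ x y → (x ==ᶜ y) ≡ true → x ≡ y
  ==ᶜ-sound (a , b) (c , d) e = cong₂ _,_ (≟-sound a c (∧-trueˡ e)) (≟-sound b d (∧-trueʳ {⌊ a ℤ.≟ c ⌋} e))

  ==ᶜ-refl : ∀ x → (x ==ᶜ x) ≡ true
  ==ᶜ-refl (a , b) rewrite ≟-refl a | ≟-refl b = refl

  ∈ᵇ-sound : ∀ x ys → x ∈ᵇ ys ≡ true → x ∈ ys
  ∈ᵇ-sound x (y ∷ ys) e with x ==ᶜ y in x=y
  ... | true  = here (==ᶜ-sound x y x=y)
  ... | false = there (∈ᵇ-sound x ys e)

  ∈ᵇ-complete : ∀ {x ys} → x ∈ ys → x ∈ᵇ ys ≡ true
  ∈ᵇ-complete {x} (here refl) rewrite ==ᶜ-refl x = refl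
  ∈ᵇ-complete {x} {y ∷ ys} (there x∈ys) with x ==ᶜ y
  ... | true  = refl
  ... | false = ∈ᵇ-complete x∈ys

  ∉ᵇ : ∀ x ys → x ∉ ys → x ∈ᵇ ys ≡ false
  ∉ᵇ x ys x∉ys = ¬-not (x∉ys ∘ ∈ᵇ-sound x ys)

  ∉ᵇ-all : ∀ x ys → All (x ≢_) ys → x ∈ᵇ ys ≡ false
  ∉ᵇ-all x ys x≢ys = ∉ᵇ x ys (λ x∈ys → All.lookup x≢ys x∈ys refl)

  ∈ᵇ-∉ᵇ : ∀ x ys → x ∈ ys → x ∈ᵇ ys ≡ false → ⊥
  ∈ᵇ-∉ᵇ x ys x∈ys e with () ← trans (sym (∈ᵇ-complete x∈ys)) e

  ∈ᵇ-nonnull : ∀ x ys → x ∈ᵇ ys ≡ true → null ys ≡ false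
  ∈ᵇ-nonnull x (y ∷ ys) _ = refl

  all-sound : ∀ {A : Set} (p : A → Bool) {xs x} → all p xs ≡ true → x ∈ xs → p x ≡ true
  all-sound p {y ∷ ys} e (here refl) = ∧-trueˡ e
  all-sound p {y ∷ ys} e (there x∈ys) = all-sound p (∧-trueʳ {p y} e) x∈ys

  all-complete : ∀ {A : Set} (p : A → Bool) xs → (∀ x → x ∈ xs → p x ≡ true) → all p xs ≡ true
  all-complete p [] _ = refl
  all-complete p (y ∷ ys) h rewrite h y (here refl) = all-complete p ys (λ x → h x ∘ there)

  all-cong : ∀ {A : Set} (p q : A → Bool) xs → (∀ x → x ∈ xs → p x ≡ q x) → all p xs ≡ all q xs
  all-cong p q [] _ = refl
  all-cong p q (y ∷ ys) h = cong₂ _∧_ (h y (here refl)) (all-cong p q ys (λ x → h x ∘ there))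

  all-∧ : ∀ {A : Set} (p q : A → Bool) xs → all (λ x → p x ∧ q x) xs ≡ all p xs ∧ all q xs
  all-∧ p q [] = refl
  all-∧ p q (y ∷ ys) rewrite all-∧ p q ys = ∧-interchange (p y) (q y) (all p ys) (all q ys)

  countᵇ-++ : ∀ {A : Set} (p : A → Bool) xs ys → countᵇ p (xs ++ ys) ≡ countᵇ p xs + countᵇ p ys
  countᵇ-++ p xs ys = trans (cong length (filter-++ (T? ∘ p) xs ys)) (length-++ (filterᵇ p xs))

  countᵇ-map : ∀ {A B : Set} (p : B → Bool) (g : A → B) xs → countᵇ p (map g xs) ≡ countᵇ (p ∘ g) xs
  countᵇ-map p g [] = refl
  countᵇ-map p g (x ∷ xs) with p (g x)
  ... | true  = cong suc (countᵇ-map p g xs)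
  ... | false = countᵇ-map p g xs

  countᵇ-cong : ∀ {A : Set} (p q : A → Bool) xs → (∀ x → p x ≡ q x) → countᵇ p xs ≡ countᵇ q xs
  countᵇ-cong p q [] _ = refl
  countᵇ-cong p q (x ∷ xs) h with p x | q x | h x
  ... | true  | true  | refl = cong suc (countᵇ-cong p q xs h)
  ... | false | false | refl = countᵇ-cong p q xs h

  countᵇ-none : ∀ {A : Set} (p : A → Bool) xs → (∀ x → p x ≡ false) → countᵇ p xs ≡ 0
  countᵇ-none p [] _ = refl
  countᵇ-none p (x ∷ xs) h with p x | h x
  ... | false | refl = countᵇ-none p xs h

  countᵇ-∷ : ∀ {A : Set} (p : A → Bool) x xs →
    countᵇ p (x ∷ xs) ≡ (if p x then suc (countᵇ p xs) else countᵇ p xs)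
  countᵇ-∷ p x xs with p x
  ... | true  = refl
  ... | false = refl

  filterᵇ-∷ : ∀ {A : Set} (p : A → Bool) x xs →
    filterᵇ p (x ∷ xs) ≡ (if p x then x ∷ filterᵇ p xs else filterᵇ p xs)
  filterᵇ-∷ p x xs with p x
  ... | true  = refl
  ... | false = refl

  ∈ᵇ-if : ∀ x u U V b → x ∈ᵇ (if b then u ∷ U else V) ≡ (if b then (x ==ᶜ u) ∨ (x ∈ᵇ U) else x ∈ᵇ V)
  ∈ᵇ-if x u U V true  = refl
  ∈ᵇ-if x u U V false = refl

  ∈ᵇ-filterᵇ : ∀ (q : Cell → Bool) x U → x ∈ᵇ filterᵇ q U ≡ (x ∈ᵇ U) ∧ q x
  ∈ᵇ-filterᵇ q x [] = refl
  ∈ᵇ-filterᵇ q x (u ∷ U) rewrite filterᵇ-∷ q u U | ∈ᵇ-if x u (filterᵇ q U) (filterᵇ q U) (q u)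
    | ∈ᵇ-filterᵇ q x U with q u in qu | x ==ᶜ u in x=u
  ... | true  | true  = sym (trans (cong q (==ᶜ-sound x u x=u)) qu)
  ... | true  | false = refl
  ... | false | true  rewrite trans (cong q (==ᶜ-sound x u x=u)) qu = ∧-zeroʳ _
  ... | false | false = refl

  fits : Tile → List Cell → Bool
  fits t U = all (_∈ᵇ U) (tileCells t)

  remove : Tile → List Cell → List Cell
  remove t U = filterᵇ (λ x → not (x ∈ᵇ tileCells t)) U

  ∈ᵇ-remove : ∀ t x U → x ∈ᵇ remove t U ≡ (x ∈ᵇ U) ∧ not (x ∈ᵇ tileCells t)
  ∈ᵇ-remove t x U = ∈ᵇ-filterᵇ (λ y → not (y ∈ᵇ tileCells t)) x U

  shift : (ℕ → ℕ) → ℕ → ℕ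
  shift g zero    = 0
  shift g (suc k) = g k

  squareShift : Tile → (ℕ → ℕ) → ℕ → ℕ
  squareShift (_ , horiz)  g = g
  squareShift (_ , vert)   g = g
  squareShift (_ , square) g = shift g

  when : Bool → ℕ → ℕ
  when true  n = n
  when false n = 0

  tilings : List Tile → List Cell → ℕ → ℕ
  tilings []       U zero    = when (null U) 1
  tilings []       U (suc k) = 0
  tilings (t ∷ ts) U k = tilings ts U k + when (fits t U) (squareShift t (tilings ts (remove t U)) k)

  indicator : Bool → ℕ
  indicator true  = 1
  indicator false = 0

  coverCount : List Tile → Cell → ℕ
  coverCount T x = countᵇ (λ t → x ∈ᵇ tileCells t) T

  insideᵇ : List Cell → List Tile → Bool
  insideᵇ R T = all (λ t → all (_∈ᵇ R) (tileCells t)) T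

  exactCoverᵇ : List Cell → List Cell → List Tile → Bool
  exactCoverᵇ R U T = insideᵇ R T ∧ all (λ x → coverCount T x ≡ᵇ indicator (x ∈ᵇ U)) R

  _⊆ᶜ_ : List Cell → List Cell → Set
  U ⊆ᶜ R = ∀ x → x ∈ᵇ U ≡ true → x ∈ᵇ R ≡ true

  remove-⊆ᶜ : ∀ t U R → U ⊆ᶜ R → remove t U ⊆ᶜ R
  remove-⊆ᶜ t U R U⊆R x e = U⊆R x (∧-trueˡ (trans (sym (∈ᵇ-remove t x U)) e))

  cover-∷ : ∀ e m c → ((if e then suc c else c) ≡ᵇ indicator m) ≡ (not e ∨ m) ∧ (c ≡ᵇ indicator (m ∧ not e))
  cover-∷ true  true  c = refl
  cover-∷ true  false c = refl
  cover-∷ false true  c = refl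
  cover-∷ false false c = refl

  fits-as-cover : ∀ R U t → U ⊆ᶜ R →
    all (_∈ᵇ R) (tileCells t) ∧ all (λ x → not (x ∈ᵇ tileCells t) ∨ (x ∈ᵇ U)) R ≡ fits t U
  fits-as-cover R U t U⊆R = bool-ext to from
    where
    to : all (_∈ᵇ R) (tileCells t) ∧ all (λ x → not (x ∈ᵇ tileCells t) ∨ (x ∈ᵇ U)) R ≡ true →
         fits t U ≡ true
    to e = all-complete (_∈ᵇ U) (tileCells t) λ y y∈t →
      subst (λ b → not b ∨ (y ∈ᵇ U) ≡ true) (∈ᵇ-complete y∈t)
        (all-sound (λ x → not (x ∈ᵇ tileCells t) ∨ (x ∈ᵇ U)) (∧-trueʳ {all (_∈ᵇ R) (tileCells t)} e)
          (∈ᵇ-sound y R (all-sound (_∈ᵇ R) (∧-trueˡ e) y∈t)))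
    covered : fits t U ≡ true → ∀ x → not (x ∈ᵇ tileCells t) ∨ (x ∈ᵇ U) ≡ true
    covered e x with x ∈ᵇ tileCells t in x∈t
    ... | false = refl
    ... | true  = all-sound (_∈ᵇ U) e (∈ᵇ-sound x (tileCells t) x∈t)
    from : fits t U ≡ true →
           all (_∈ᵇ R) (tileCells t) ∧ all (λ x → not (x ∈ᵇ tileCells t) ∨ (x ∈ᵇ U)) R ≡ true
    from e rewrite all-complete (_∈ᵇ R) (tileCells t) (λ y y∈t → U⊆R y (all-sound (_∈ᵇ U) e y∈t)) =
      all-complete _ R (λ x _ → covered e x)

  exactCover-∷ : ∀ R U t T → U ⊆ᶜ R → exactCoverᵇ R U (t ∷ T) ≡ fits t U ∧ exactCoverᵇ R (remove t U) T
  exactCover-∷ R U t T U⊆R = begin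
      (inT ∧ insideᵇ R T) ∧ all (λ x → coverCount (t ∷ T) x ≡ᵇ indicator (x ∈ᵇ U)) R
    ≡⟨ cong ((inT ∧ insideᵇ R T) ∧_) split ⟩
      (inT ∧ insideᵇ R T) ∧ (t⊆U ∧ all (λ x → coverCount T x ≡ᵇ indicator (x ∈ᵇ remove t U)) R)
    ≡⟨ ∧-interchange inT (insideᵇ R T) t⊆U _ ⟩
      (inT ∧ t⊆U) ∧ exactCoverᵇ R (remove t U) T
    ≡⟨ cong (_∧ exactCoverᵇ R (remove t U) T) (fits-as-cover R U t U⊆R) ⟩
      fits t U ∧ exactCoverᵇ R (remove t U) T
    ∎
    where
    open ≡-Reasoning
    inT t⊆U : Bool
    inT = all (_∈ᵇ R) (tileCells t)
    t⊆U = all (λ x → not (x ∈ᵇ tileCells t) ∨ (x ∈ᵇ U)) R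
    split : all (λ x → coverCount (t ∷ T) x ≡ᵇ indicator (x ∈ᵇ U)) R ≡
            t⊆U ∧ all (λ x → coverCount T x ≡ᵇ indicator (x ∈ᵇ remove t U)) R
    split = trans (all-cong _ _ R (λ x _ →
              trans (cong (_≡ᵇ indicator (x ∈ᵇ U)) (countᵇ-∷ (λ t' → x ∈ᵇ tileCells t') t T))
              (trans (cover-∷ (x ∈ᵇ tileCells t) (x ∈ᵇ U) (coverCount T x))
                (cong (λ b → (not (x ∈ᵇ tileCells t) ∨ (x ∈ᵇ U)) ∧ (coverCount T x ≡ᵇ indicator b))
                   (sym (∈ᵇ-remove t x U))))))
            (all-∧ _ _ R)

  exactCover-[] : ∀ R U → U ⊆ᶜ R → all (λ x → 0 ≡ᵇ indicator (x ∈ᵇ U)) R ≡ null U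
  exactCover-[] R [] _ = all-complete _ R (λ _ _ → refl)
  exactCover-[] R (u ∷ U) U⊆R = ¬-not uncovered
    where
    u∈u∷U : u ∈ᵇ (u ∷ U) ≡ true
    u∈u∷U = ∈ᵇ-complete {u} {u ∷ U} (here refl)
    uncovered : all (λ x → 0 ≡ᵇ indicator (x ∈ᵇ (u ∷ U))) R ≢ true
    uncovered e with all-sound (λ x → 0 ≡ᵇ indicator (x ∈ᵇ (u ∷ U))) e (∈ᵇ-sound u R (U⊆R u u∈u∷U))
    ... | e' rewrite u∈u∷U with () ← e'

  squareCount : List Tile → ℕ
  squareCount T = countᵇ isSquare T

  countᵇ-sublists : ∀ {A : Set} (p : List A → Bool) x xs →
    countᵇ p (sublists (x ∷ xs)) ≡ countᵇ p (sublists xs) + countᵇ (p ∘ (x ∷_)) (sublists xs)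
  countᵇ-sublists p x xs =
    trans (countᵇ-++ p (sublists xs) _) (cong (countᵇ p (sublists xs) +_) (countᵇ-map p (x ∷_) (sublists xs)))

  exactCovers≡tilings : ∀ R ts U → U ⊆ᶜ R → ∀ k →
    countᵇ (λ T → exactCoverᵇ R U T ∧ (squareCount T ≡ᵇ k)) (sublists ts) ≡ tilings ts U k
  exactCovers≡tilings R [] U U⊆R zero rewrite exactCover-[] R U U⊆R with null U
  ... | true  = refl
  ... | false = refl
  exactCovers≡tilings R [] U U⊆R (suc k) rewrite exactCover-[] R U U⊆R with null U
  ... | true  = refl
  ... | false = refl
  exactCovers≡tilings R (t ∷ ts) U U⊆R k =
    trans (countᵇ-sublists _ t ts) (cong₂ _+_ (exactCovers≡tilings R ts U U⊆R k) usingT)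
    where
    IH : ∀ k → countᵇ (λ T → exactCoverᵇ R (remove t U) T ∧ (squareCount T ≡ᵇ k)) (sublists ts)
                 ≡ tilings ts (remove t U) k
    IH = exactCovers≡tilings R ts (remove t U) (remove-⊆ᶜ t U R U⊆R)
    afterT : ∀ t' k → countᵇ (λ T → exactCoverᵇ R (remove t U) T ∧ (squareCount (t' ∷ T) ≡ᵇ k)) (sublists ts)
                        ≡ squareShift t' (tilings ts (remove t U)) k
    afterT (_ , horiz)  k       = IH k
    afterT (_ , vert)   k       = IH k
    afterT (_ , square) zero    = countᵇ-none _ (sublists ts) (λ _ → ∧-zeroʳ _)
    afterT (_ , square) (suc k) = IH k
    usingT : countᵇ (λ T → exactCoverᵇ R U (t ∷ T) ∧ (squareCount (t ∷ T) ≡ᵇ k)) (sublists ts)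
             ≡ when (fits t U) (squareShift t (tilings ts (remove t U)) k)
    usingT rewrite countᵇ-cong (λ T → exactCoverᵇ R U (t ∷ T) ∧ (squareCount (t ∷ T) ≡ᵇ k))
                     (λ T → (fits t U ∧ exactCoverᵇ R (remove t U) T) ∧ (squareCount (t ∷ T) ≡ᵇ k)) (sublists ts)
                     (λ T → cong (_∧ (squareCount (t ∷ T) ≡ᵇ k)) (exactCover-∷ R U t T U⊆R))
            with fits t U
    ... | false = countᵇ-none _ (sublists ts) (λ _ → refl)
    ... | true  = afterT t k

  f≡tilings : ∀ R k → f R k ≡ tilings (candidates R) R k
  f≡tilings R k =
    trans (countᵇ-cong _ _ (sublists (candidates R)) λ T →
             cong (λ b → (insideᵇ R T ∧ b) ∧ (squareCount T ≡ᵇ k))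
               (all-cong _ _ R (λ x x∈R → cong (λ b → coverCount T x ≡ᵇ indicator b) (sym (∈ᵇ-complete x∈R)))))
          (exactCovers≡tilings R (candidates R) R (λ _ e → e) k)

  _≐ᶜ_ : List Cell → List Cell → Set
  U ≐ᶜ V = ∀ x → x ∈ᵇ U ≡ x ∈ᵇ V

  ≐ᶜ-trans : ∀ U V W → U ≐ᶜ V → V ≐ᶜ W → U ≐ᶜ W
  ≐ᶜ-trans U V W U≐V V≐W x = trans (U≐V x) (V≐W x)

  null-cong : ∀ U V → U ≐ᶜ V → null U ≡ null V
  null-cong []      []      _   = refl
  null-cong []      (v ∷ V) U≐V with () ← trans (U≐V v) (∈ᵇ-complete {v} {v ∷ V} (here refl))
  null-cong (u ∷ U) []      U≐V with () ← trans (sym (U≐V u)) (∈ᵇ-complete {u} {u ∷ U} (here refl))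
  null-cong (u ∷ U) (v ∷ V) _   = refl

  fits-cong : ∀ t U V → U ≐ᶜ V → fits t U ≡ fits t V
  fits-cong t U V U≐V = all-cong _ _ (tileCells t) (λ x _ → U≐V x)

  remove-cong : ∀ t U V → U ≐ᶜ V → remove t U ≐ᶜ remove t V
  remove-cong t U V U≐V x rewrite ∈ᵇ-remove t x U | ∈ᵇ-remove t x V | U≐V x = refl

  shift-cong : ∀ (g h : ℕ → ℕ) → (∀ k → g k ≡ h k) → ∀ k → shift g k ≡ shift h k
  shift-cong g h g≗h zero    = refl
  shift-cong g h g≗h (suc k) = g≗h k

  squareShift-cong : ∀ t (g h : ℕ → ℕ) → (∀ k → g k ≡ h k) → ∀ k → squareShift t g k ≡ squareShift t h k
  squareShift-cong (_ , horiz)  g h g≗h = g≗h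
  squareShift-cong (_ , vert)   g h g≗h = g≗h
  squareShift-cong (_ , square) g h g≗h = shift-cong g h g≗h

  tilings-cong : ∀ ts U V → U ≐ᶜ V → ∀ k → tilings ts U k ≡ tilings ts V k
  tilings-cong []       U V U≐V zero rewrite null-cong U V U≐V = refl
  tilings-cong []       U V U≐V (suc k) = refl
  tilings-cong (t ∷ ts) U V U≐V k rewrite fits-cong t U V U≐V =
    cong₂ _+_ (tilings-cong ts U V U≐V k)
      (cong (when (fits t V))
        (squareShift-cong t _ _ (tilings-cong ts (remove t U) (remove t V) (remove-cong t U V U≐V)) k))

  tilings-∷-cong : ∀ t ts ts' → (∀ U k → tilings ts U k ≡ tilings ts' U k) →
                   ∀ U k → tilings (t ∷ ts) U k ≡ tilings (t ∷ ts') U k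
  tilings-∷-cong t ts ts' ts≗ts' U k =
    cong₂ _+_ (ts≗ts' U k) (cong (when (fits t U)) (squareShift-cong t _ _ (ts≗ts' (remove t U)) k))

  squareShift-zero : ∀ t (g : ℕ → ℕ) → (∀ k → g k ≡ 0) → ∀ k → squareShift t g k ≡ 0
  squareShift-zero (_ , horiz)  g g≡0 k       = g≡0 k
  squareShift-zero (_ , vert)   g g≡0 k       = g≡0 k
  squareShift-zero (_ , square) g g≡0 zero    = refl
  squareShift-zero (_ , square) g g≡0 (suc k) = g≡0 k

  when-zero : ∀ b → when b 0 ≡ 0
  when-zero true  = refl
  when-zero false = refl

  tilings-uncoverable : ∀ ts U x → x ∈ᵇ U ≡ true → All (λ t → x ∈ᵇ tileCells t ≡ false) ts →
                        ∀ k → tilings ts U k ≡ 0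
  tilings-uncoverable [] U x x∈U [] zero rewrite ∈ᵇ-nonnull x U x∈U = refl
  tilings-uncoverable [] U x x∈U [] (suc k) = refl
  tilings-uncoverable (t ∷ ts) U x x∈U (x∉t ∷ x∉ts) k
    rewrite tilings-uncoverable ts U x x∈U x∉ts k
          | squareShift-zero t (tilings ts (remove t U))
              (tilings-uncoverable ts (remove t U) x
                 (trans (∈ᵇ-remove t x U) (cong₂ (λ a b → a ∧ not b) x∈U x∉t)) x∉ts) k
          | when-zero (fits t U) = refl

  disjointᵇ-sym : ∀ A B → all (λ y → not (y ∈ᵇ B)) A ≡ all (λ y → not (y ∈ᵇ A)) B
  disjointᵇ-sym A B = bool-ext (flip A B) (flip B A)
    where
    flip : ∀ A B → all (λ y → not (y ∈ᵇ B)) A ≡ true → all (λ y → not (y ∈ᵇ A)) B ≡ true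
    flip A B A∩B=∅ = all-complete _ B notInA
      where
      notInA : ∀ y → y ∈ B → not (y ∈ᵇ A) ≡ true
      notInA y y∈B with y ∈ᵇ A in y∈A
      ... | false = refl
      ... | true  with all-sound _ A∩B=∅ (∈ᵇ-sound y A y∈A)
      ...   | y∉B rewrite ∈ᵇ-complete y∈B with () ← y∉B

  fits-remove : ∀ u t U → fits u (remove t U) ≡ fits u U ∧ all (λ y → not (y ∈ᵇ tileCells t)) (tileCells u)
  fits-remove u t U = trans (all-cong _ _ (tileCells u) (λ x _ → ∈ᵇ-remove t x U)) (all-∧ _ _ (tileCells u))

  fits-comm : ∀ t u U → fits t U ∧ fits u (remove t U) ≡ fits u U ∧ fits t (remove u U)
  fits-comm t u U rewrite fits-remove u t U | fits-remove t u U
    | disjointᵇ-sym (tileCells u) (tileCells t) with fits t U | fits u U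
  ... | false | false = refl
  ... | false | true  = refl
  ... | true  | false = refl
  ... | true  | true  = refl

  remove-comm : ∀ t u U → remove u (remove t U) ≐ᶜ remove t (remove u U)
  remove-comm t u U x rewrite ∈ᵇ-remove u x (remove t U) | ∈ᵇ-remove t x (remove u U)
    | ∈ᵇ-remove t x U | ∈ᵇ-remove u x U with x ∈ᵇ U | x ∈ᵇ tileCells t | x ∈ᵇ tileCells u
  ... | false | _     | _     = refl
  ... | true  | false | false = refl
  ... | true  | false | true  = refl
  ... | true  | true  | false = refl
  ... | true  | true  | true  = refl

  squareShift-+ : ∀ t (g h : ℕ → ℕ) k → squareShift t (λ k → g k + h k) k ≡ squareShift t g k + squareShift t h k
  squareShift-+ (_ , horiz)  g h k       = refl
  squareShift-+ (_ , vert)   g h k       = refl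
  squareShift-+ (_ , square) g h zero    = refl
  squareShift-+ (_ , square) g h (suc k) = refl

  squareShift-when : ∀ t b (h : ℕ → ℕ) k → squareShift t (λ k → when b (h k)) k ≡ when b (squareShift t h k)
  squareShift-when (_ , horiz)  b h k       = refl
  squareShift-when (_ , vert)   b h k       = refl
  squareShift-when (_ , square) b h zero    = sym (when-zero b)
  squareShift-when (_ , square) b h (suc k) = refl

  squareShift-comm : ∀ t u (g : ℕ → ℕ) k → squareShift t (squareShift u g) k ≡ squareShift u (squareShift t g) k
  squareShift-comm (_ , horiz)  u g k = refl
  squareShift-comm (_ , vert)   u g k = refl
  squareShift-comm (_ , square) (_ , horiz)  g k = refl
  squareShift-comm (_ , square) (_ , vert)   g k = refl
  squareShift-comm (_ , square) (_ , square) g zero          = refl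
  squareShift-comm (_ , square) (_ , square) g (suc zero)    = refl
  squareShift-comm (_ , square) (_ , square) g (suc (suc k)) = refl

  when-+ : ∀ b m n → when b (m + n) ≡ when b m + when b n
  when-+ true  m n = refl
  when-+ false m n = refl

  when-when : ∀ a b n → when a (when b n) ≡ when (a ∧ b) n
  when-when true  b n = refl
  when-when false b n = refl

  usingTile : Tile → List Tile → List Cell → ℕ → ℕ
  usingTile t ts U k = when (fits t U) (squareShift t (tilings ts (remove t U)) k)

  usingBoth : Tile → Tile → List Tile → List Cell → ℕ → ℕ
  usingBoth t u ts U k =
    when (fits t U ∧ fits u (remove t U)) (squareShift t (squareShift u (tilings ts (remove u (remove t U)))) k)

  usingTile-∷ : ∀ t u ts U k → usingTile t (u ∷ ts) U k ≡ usingTile t ts U k + usingBoth t u ts U k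
  usingTile-∷ t u ts U k = begin
      when (fits t U) (squareShift t (tilings (u ∷ ts) (remove t U)) k)
    ≡⟨ cong (when (fits t U)) (squareShift-+ t _ _ k) ⟩
      when (fits t U) (withoutU + squareShift t (λ k′ → when fitsU (afterU k′)) k)
    ≡⟨ cong (λ z → when (fits t U) (withoutU + z)) (squareShift-when t fitsU afterU k) ⟩
      when (fits t U) (withoutU + when fitsU (squareShift t afterU k))
    ≡⟨ when-+ (fits t U) _ _ ⟩
      when (fits t U) withoutU + when (fits t U) (when fitsU (squareShift t afterU k))
    ≡⟨ cong (when (fits t U) withoutU +_) (when-when (fits t U) fitsU _) ⟩
      usingTile t ts U k + usingBoth t u ts U k
    ∎
    where
    open ≡-Reasoning
    withoutU : ℕ
    withoutU = squareShift t (tilings ts (remove t U)) k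
    fitsU : Bool
    fitsU = fits u (remove t U)
    afterU : ℕ → ℕ
    afterU = squareShift u (tilings ts (remove u (remove t U)))

  usingBoth-comm : ∀ t u ts U k → usingBoth t u ts U k ≡ usingBoth u t ts U k
  usingBoth-comm t u ts U k rewrite fits-comm t u U =
    cong (when (fits u U ∧ fits t (remove u U)))
      (trans (squareShift-comm t u _ k)
        (squareShift-cong u _ _ (squareShift-cong t _ _ (tilings-cong ts _ _ (remove-comm t u U))) k))

  tilings-swap : ∀ t u ts U k → tilings (t ∷ u ∷ ts) U k ≡ tilings (u ∷ t ∷ ts) U k
  tilings-swap t u ts U k = begin
      (tilings ts U k + usingTile u ts U k) + usingTile t (u ∷ ts) U k
    ≡⟨ cong (_ +_) (usingTile-∷ t u ts U k) ⟩
      (tilings ts U k + usingTile u ts U k) + (usingTile t ts U k + usingBoth t u ts U k)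
    ≡⟨ cong (λ z → (tilings ts U k + usingTile u ts U k) + (usingTile t ts U k + z)) (usingBoth-comm t u ts U k) ⟩
      (tilings ts U k + usingTile u ts U k) + (usingTile t ts U k + usingBoth u t ts U k)
    ≡⟨ interchange (tilings ts U k) (usingTile u ts U k) (usingTile t ts U k) _ ⟩
      (tilings ts U k + usingTile t ts U k) + (usingTile u ts U k + usingBoth u t ts U k)
    ≡⟨ cong (_ +_) (usingTile-∷ u t ts U k) ⟨
      (tilings ts U k + usingTile t ts U k) + usingTile u (t ∷ ts) U k
    ∎
    where
    open ≡-Reasoning
    interchange : ∀ a b c d → (a + b) + (c + d) ≡ (a + c) + (b + d)
    interchange = ℕSolver.solve-∀

  tilings-↭ : ∀ {ts ts'} → ts ↭ ts' → ∀ U k → tilings ts U k ≡ tilings ts' U k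
  tilings-↭ Perm.refl = λ _ _ → refl
  tilings-↭ (Perm.prep {xs} {ys} t p) = tilings-∷-cong t xs ys (tilings-↭ p)
  tilings-↭ (Perm.swap {xs} {ys} t u p) U k =
    trans (tilings-swap t u xs U k) (tilings-∷-cong u (t ∷ xs) (t ∷ ys) (tilings-∷-cong t xs ys (tilings-↭ p)) U k)
  tilings-↭ (Perm.trans p q) U k = trans (tilings-↭ p U k) (tilings-↭ q U k)

  tilings-++-comm : ∀ xs ys U k → tilings (xs ++ ys) U k ≡ tilings (ys ++ xs) U k
  tilings-++-comm xs ys = tilings-↭ (++-comm xs ys)

  tilings-skip : ∀ t ts U k → fits t U ≡ false → tilings (t ∷ ts) U k ≡ tilings ts U k
  tilings-skip t ts U k ¬fit rewrite ¬fit = ℕP.+-identityʳ _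

  tilings-skips : ∀ xs ts U k → All (λ t → fits t U ≡ false) xs → tilings (xs ++ ts) U k ≡ tilings ts U k
  tilings-skips []       ts U k []           = refl
  tilings-skips (x ∷ xs) ts U k (¬fit ∷ ¬fits) =
    trans (tilings-skip x (xs ++ ts) U k ¬fit) (tilings-skips xs ts U k ¬fits)

  tilings-place : ∀ t ts U k → fits t U ≡ true →
                  tilings (t ∷ ts) U k ≡ tilings ts U k + squareShift t (tilings ts (remove t U)) k
  tilings-place t ts U k fit rewrite fit = refl

  fits-false : ∀ {x} t U → x ∈ tileCells t → x ∈ᵇ U ≡ false → fits t U ≡ false
  fits-false t U x∈t x∉U = ¬-not λ fit → case trans (sym x∉U) (all-sound (_∈ᵇ U) fit x∈t) of λ ()

  fits-true : ∀ t U → (∀ x → x ∈ tileCells t → x ∈ᵇ U ≡ true) → fits t U ≡ true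
  fits-true t U = all-complete (_∈ᵇ U) (tileCells t)

  remove-keepsᵇ : ∀ t x U → x ∈ᵇ U ≡ true → x ∈ᵇ tileCells t ≡ false → x ∈ᵇ remove t U ≡ true
  remove-keepsᵇ t x U x∈U x∉t rewrite ∈ᵇ-remove t x U | x∈U | x∉t = refl

  remove-keeps : ∀ t x U → x ∈ᵇ U ≡ true → All (x ≢_) (tileCells t) → x ∈ᵇ remove t U ≡ true
  remove-keeps t x U x∈U x∉t = remove-keepsᵇ t x U x∈U (∉ᵇ-all x (tileCells t) x∉t)

  remove-absent : ∀ t x U → x ∈ᵇ U ≡ false → x ∈ᵇ remove t U ≡ false
  remove-absent t x U x∉U rewrite ∈ᵇ-remove t x U | x∉U = refl

  remove-covered : ∀ t x U → x ∈ tileCells t → x ∈ᵇ remove t U ≡ false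
  remove-covered t x U x∈t rewrite ∈ᵇ-remove t x U | ∈ᵇ-complete x∈t = ∧-zeroʳ _

  ∈ᵇ-remove⁻ : ∀ t x U → x ∈ᵇ remove t U ≡ true → (x ∈ᵇ U ≡ true) × (x ∈ᵇ tileCells t ≡ false)
  ∈ᵇ-remove⁻ t x U e rewrite ∈ᵇ-remove t x U with x ∈ᵇ U | x ∈ᵇ tileCells t
  ... | true | false = refl , refl

module LadderTilings where

  open import Data.Nat using (_+_)
  open import Data.Integer using (+_)
  open Counting

  InRect : ℕ → Cell → Set
  InRect n x = Σ ℕ λ a → Σ ℕ λ b → (x ≡ (+ a , + b)) × (a ≤ n) × (b ≤ 1)

  ∈-rect⁻ : ∀ n x → x ∈ rect n → InRect n x
  ∈-rect⁻ zero x (here refl)         = 0 , 0 , refl , z≤n , z≤n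
  ∈-rect⁻ zero x (there (here refl)) = 0 , 1 , refl , z≤n , s≤s z≤n
  ∈-rect⁻ (suc n) x x∈ with ∈-++⁻ (rect n) x∈
  ... | inj₁ x∈rect with ∈-rect⁻ n x x∈rect
  ...   | a , b , refl , a≤n , b≤1 = a , b , refl , ℕP.m≤n⇒m≤1+n a≤n , b≤1
  ∈-rect⁻ (suc n) x x∈ | inj₂ (here refl)         = suc n , 0 , refl , ℕP.≤-refl , z≤n
  ∈-rect⁻ (suc n) x x∈ | inj₂ (there (here refl)) = suc n , 1 , refl , ℕP.≤-refl , s≤s z≤n

  ∈-rect⁺ : ∀ n a b → a ≤ n → b ≤ 1 → (+ a , + b) ∈ rect n
  ∈-rect⁺ zero    zero zero          z≤n _         = here refl
  ∈-rect⁺ zero    zero (suc zero)    z≤n _         = there (here refl)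
  ∈-rect⁺ zero    zero (suc (suc _)) z≤n (s≤s ())
  ∈-rect⁺ (suc n) a    b             a≤1+n b≤1 with ℕP.m≤n⇒m<n∨m≡n a≤1+n
  ... | inj₁ (s≤s a≤n) = ∈-++⁺ˡ (∈-rect⁺ n a b a≤n b≤1)
  ∈-rect⁺ (suc n) a zero          _ _         | inj₂ refl = ∈-++⁺ʳ (rect n) (here refl)
  ∈-rect⁺ (suc n) a (suc zero)    _ _         | inj₂ refl = ∈-++⁺ʳ (rect n) (there (here refl))
  ∈-rect⁺ (suc n) a (suc (suc _)) _ (s≤s ())  | inj₂ refl

  ∈ᵇ-rect⁺ : ∀ n a b → a ≤ n → b ≤ 1 → (+ a , + b) ∈ᵇ rect n ≡ true
  ∈ᵇ-rect⁺ n a b a≤n b≤1 = ∈ᵇ-complete (∈-rect⁺ n a b a≤n b≤1)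

  ∈ᵇ-rect⁻ : ∀ n x → x ∈ᵇ rect n ≡ true → InRect n x
  ∈ᵇ-rect⁻ n x x∈ = ∈-rect⁻ n x (∈ᵇ-sound x (rect n) x∈)

  ∉ᵇ-rect : ∀ n x → (InRect n x → ⊥) → x ∈ᵇ rect n ≡ false
  ∉ᵇ-rect n x x∉ = ∉ᵇ x (rect n) (x∉ ∘ ∈-rect⁻ n x)

  ∉ᵇ-rect-beyond : ∀ n c (b : ℤ) → n < c → (+ c , b) ∈ᵇ rect n ≡ false
  ∉ᵇ-rect-beyond n c b n<c = ∉ᵇ-rect n (+ c , b) λ { (a , _ , refl , a≤n , _) → ℕP.<⇒≱ n<c a≤n }

  ∉ᵇ-rect-row₂ : ∀ n c → (+ c , + 2) ∈ᵇ rect n ≡ false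
  ∉ᵇ-rect-row₂ n c = ∉ᵇ-rect n (+ c , + 2) λ { (_ , _ , refl , _ , s≤s ()) }

  ≢-column : ∀ {a c} {b d : ℤ} → a ≢ c → _≢_ {A = Cell} (+ a , b) (+ c , d)
  ≢-column a≢c refl = a≢c refl

  column : ℕ → List Tile
  column j = candidates ((+ j , + 0) ∷ (+ j , + 1) ∷ [])

  candidates-++ : ∀ xs ys → candidates (xs ++ ys) ≡ candidates xs ++ candidates ys
  candidates-++ []       ys = refl
  candidates-++ (x ∷ xs) ys = cong (λ ts → (x , horiz) ∷ (x , vert) ∷ (x , square) ∷ ts) (candidates-++ xs ys)

  candidates-rect-suc : ∀ n → candidates (rect (suc n)) ≡ candidates (rect n) ++ column (suc n)
  candidates-rect-suc n = candidates-++ (rect n) _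

  UpToColumn : ℕ → Cell → Set
  UpToColumn n y = Σ ℕ λ c → Σ ℕ λ d → (y ≡ (+ c , + d)) × (c ≤ n)

  TileUpToColumn : ℕ → Tile → Set
  TileUpToColumn n t = All (UpToColumn n) (tileCells t)

  column-upTo : ∀ n j → j ≤ n → All (TileUpToColumn (suc n)) (column j)
  column-upTo n j j≤n =
      ((j , 0 , refl , l₀) ∷ (j + 1 , 0 , refl , l₁) ∷ [])
    ∷ ((j , 0 , refl , l₀) ∷ (j , 1 , refl , l₀) ∷ [])
    ∷ ((j , 0 , refl , l₀) ∷ (j + 1 , 0 , refl , l₁) ∷ (j , 1 , refl , l₀) ∷ (j + 1 , 1 , refl , l₁) ∷ [])
    ∷ ((j , 1 , refl , l₀) ∷ (j + 1 , 1 , refl , l₁) ∷ [])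
    ∷ ((j , 1 , refl , l₀) ∷ (j , 2 , refl , l₀) ∷ [])
    ∷ ((j , 1 , refl , l₀) ∷ (j + 1 , 1 , refl , l₁) ∷ (j , 2 , refl , l₀) ∷ (j + 1 , 2 , refl , l₁) ∷ [])
    ∷ []
    where
    l₀ : j ≤ suc n
    l₀ = ℕP.m≤n⇒m≤1+n j≤n
    l₁ : j + 1 ≤ suc n
    l₁ = subst (_≤ suc n) (ℕP.+-comm 1 j) (s≤s j≤n)

  candidates-upTo : ∀ n → All (TileUpToColumn (suc n)) (candidates (rect n))
  candidates-upTo zero = column-upTo 0 0 z≤n
  candidates-upTo (suc n) rewrite candidates-rect-suc n =
    ++⁺ (All.map (All.map widen) (candidates-upTo n)) (column-upTo (suc n) (suc n) ℕP.≤-refl)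
    where
    widen : ∀ {y} → UpToColumn (suc n) y → UpToColumn (suc (suc n)) y
    widen (c , d , y≡ , c≤) = c , d , y≡ , ℕP.m≤n⇒m≤1+n c≤

  candidates-miss : ∀ n x → (∀ c d → x ≡ (+ c , + d) → c ≤ suc n → ⊥) →
                    All (λ t → x ∈ᵇ tileCells t ≡ false) (candidates (rect n))
  candidates-miss n x x-far = All.map (λ {t} cells → ∉ᵇ-all x (tileCells t) (All.map miss cells)) (candidates-upTo n)
    where
    miss : ∀ {y} → UpToColumn (suc n) y → x ≢ y
    miss (c , d , refl , c≤) x≡y = x-far c d x≡y c≤

  candidates-miss-row₋₁ : ∀ n a → All (λ t → (+ a , -1ℤ) ∈ᵇ tileCells t ≡ false) (candidates (rect n))
  candidates-miss-row₋₁ n a = candidates-miss n (+ a , -1ℤ) λ _ _ ()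

  candidates-miss-column : ∀ n b → All (λ t → (+ (suc n + 1) , b) ∈ᵇ tileCells t ≡ false) (candidates (rect n))
  candidates-miss-column n b = candidates-miss n (+ (suc n + 1) , b) λ { _ _ refl c≤ → ℕP.m+1+n≰m (suc n) c≤ }

  module Column (j : ℕ) where

    c00 c01 c02 c10 c11 : Cell
    c00 = (+ j , + 0)
    c01 = (+ j , + 1)
    c02 = (+ j , + 2)
    c10 = (+ (j + 1) , + 0)
    c11 = (+ (j + 1) , + 1)

    horiz₀ vert₀ square₀ horiz₁ vert₁ square₁ : Tile
    horiz₀  = (c00 , horiz)
    vert₀   = (c00 , vert)
    square₀ = (c00 , square)
    horiz₁  = (c01 , horiz)
    vert₁   = (c01 , vert)
    square₁ = (c01 , square)

    c10≢c0 : ∀ {b c : ℤ} → _≢_ {A = Cell} (+ (j + 1) , b) (+ j , c)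
    c10≢c0 = ≢-column (ℕP.m+1+n≢m j {0})

    fits-horiz₁ : ∀ U → c01 ∈ᵇ U ≡ true → c11 ∈ᵇ U ≡ true → fits horiz₁ U ≡ true
    fits-horiz₁ U c01∈ c11∈ = fits-true horiz₁ U λ { _ (here refl) → c01∈ ; _ (there (here refl)) → c11∈ }

    skip-vert₁-square₁ : ∀ ts V k → c02 ∈ᵇ V ≡ false →
                         tilings (vert₁ ∷ square₁ ∷ ts) V k ≡ tilings ts V k
    skip-vert₁-square₁ ts V k c02∉ = tilings-skips (vert₁ ∷ square₁ ∷ []) ts V k
      (fits-false vert₁ V (there (here refl)) c02∉ ∷ fits-false square₁ V (there (there (here refl))) c02∉ ∷ [])

    tilings-column-unusable : ∀ ts U k → c00 ∈ᵇ U ≡ false → c11 ∈ᵇ U ≡ false → c02 ∈ᵇ U ≡ false →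
                              tilings (column j ++ ts) U k ≡ tilings ts U k
    tilings-column-unusable ts U k c00∉ c11∉ c02∉ = tilings-skips (column j) ts U k
      (  fits-false horiz₀ U (here refl) c00∉ ∷ fits-false vert₀ U (here refl) c00∉
       ∷ fits-false square₀ U (here refl) c00∉ ∷ fits-false horiz₁ U (there (here refl)) c11∉
       ∷ fits-false vert₁ U (there (here refl)) c02∉ ∷ fits-false square₁ U (there (there (here refl))) c02∉ ∷ [])

    tilings-column-upper : ∀ ts U k → c00 ∈ᵇ U ≡ false → c01 ∈ᵇ U ≡ true → c11 ∈ᵇ U ≡ true →
                           c02 ∈ᵇ U ≡ false →
                           tilings (column j ++ ts) U k ≡ tilings ts U k + tilings ts (remove horiz₁ U) k
    tilings-column-upper ts U k c00∉ c01∈ c11∈ c02∉ =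
      trans (tilings-skips (horiz₀ ∷ vert₀ ∷ square₀ ∷ []) (horiz₁ ∷ vert₁ ∷ square₁ ∷ ts) U k
              (fits-false horiz₀ U (here refl) c00∉ ∷ fits-false vert₀ U (here refl) c00∉
               ∷ fits-false square₀ U (here refl) c00∉ ∷ []))
      (trans (tilings-place horiz₁ (vert₁ ∷ square₁ ∷ ts) U k (fits-horiz₁ U c01∈ c11∈))
        (cong₂ _+_ (skip-vert₁-square₁ ts U k c02∉)
                   (skip-vert₁-square₁ ts (remove horiz₁ U) k (remove-absent horiz₁ c02 U c02∉))))

    tilings-column-vertical : ∀ ts U k → c00 ∈ᵇ U ≡ true → c01 ∈ᵇ U ≡ true → c10 ∈ᵇ U ≡ false →
                              c11 ∈ᵇ U ≡ false → c02 ∈ᵇ U ≡ false →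
                              tilings (column j ++ ts) U k ≡ tilings ts U k + tilings ts (remove vert₀ U) k
    tilings-column-vertical ts U k c00∈ c01∈ c10∉ c11∉ c02∉ =
      trans (tilings-skip horiz₀ (vert₀ ∷ upper ++ ts) U k (fits-false horiz₀ U (there (here refl)) c10∉))
      (trans (tilings-place vert₀ (upper ++ ts) U k
               (fits-true vert₀ U λ { _ (here refl) → c00∈ ; _ (there (here refl)) → c01∈ }))
        (cong₂ _+_
          (tilings-skips upper ts U k
            (  fits-false square₀ U (there (here refl)) c10∉ ∷ fits-false horiz₁ U (there (here refl)) c11∉
             ∷ fits-false vert₁ U (there (here refl)) c02∉ ∷ fits-false square₁ U (there (here refl)) c11∉ ∷ []))
          (tilings-skips upper ts V k
            (  fits-false square₀ V (here refl) (remove-covered vert₀ c00 U (here refl))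
             ∷ fits-false horiz₁ V (here refl) c01-covered ∷ fits-false vert₁ V (here refl) c01-covered
             ∷ fits-false square₁ V (here refl) c01-covered ∷ []))))
      where
      upper : List Tile
      upper = square₀ ∷ horiz₁ ∷ vert₁ ∷ square₁ ∷ []
      V : List Cell
      V = remove vert₀ U
      c01-covered : c01 ∈ᵇ V ≡ false
      c01-covered = remove-covered vert₀ c01 U (there (here refl))

    module _ (ts : List Tile) (U : List Cell)
             (c00∈ : c00 ∈ᵇ U ≡ true) (c01∈ : c01 ∈ᵇ U ≡ true) (c10∈ : c10 ∈ᵇ U ≡ true)
             (c11∈ : c11 ∈ᵇ U ≡ true) (c02∉ : c02 ∈ᵇ U ≡ false)
             (c10-unreached : All (λ t → c10 ∈ᵇ tileCells t ≡ false) ts)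
             (c11-unreached : All (λ t → c11 ∈ᵇ tileCells t ≡ false) ts) where

      private
        upper : List Tile
        upper = horiz₁ ∷ vert₁ ∷ square₁ ∷ ts

        c10-uncovered : ∀ k → tilings upper U k ≡ 0
        c10-uncovered k =
          trans (tilings-place horiz₁ (vert₁ ∷ square₁ ∷ ts) U k (fits-horiz₁ U c01∈ c11∈))
            (cong₂ _+_
              (trans (skip-vert₁-square₁ ts U k c02∉) (tilings-uncoverable ts U c10 c10∈ c10-unreached k))
              (trans (skip-vert₁-square₁ ts (remove horiz₁ U) k (remove-absent horiz₁ c02 U c02∉))
                (tilings-uncoverable ts (remove horiz₁ U) c10
                  (remove-keeps horiz₁ c10 U c10∈ (c10≢c0 ∷ (λ ()) ∷ [])) c10-unreached k)))

        after-square₀ : ∀ k → tilings upper (remove square₀ U) k ≡ tilings ts (remove square₀ U) k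
        after-square₀ k =
          trans (tilings-skip horiz₁ (vert₁ ∷ square₁ ∷ ts) (remove square₀ U) k
                  (fits-false horiz₁ (remove square₀ U) (here refl)
                    (remove-covered square₀ c01 U (there (there (here refl))))))
            (skip-vert₁-square₁ ts (remove square₀ U) k (remove-absent square₀ c02 U c02∉))

        with-square₀ : ∀ k → tilings (square₀ ∷ upper) U k ≡ shift (tilings ts (remove square₀ U)) k
        with-square₀ k =
          trans (tilings-place square₀ upper U k
                  (fits-true square₀ U λ { _ (here refl) → c00∈ ; _ (there (here refl)) → c10∈
                                         ; _ (there (there (here refl))) → c01∈
                                         ; _ (there (there (there (here refl)))) → c11∈ }))
            (cong₂ _+_ (c10-uncovered k) (squareShift-cong square₀ _ _ after-square₀ k))

        after-vert₀ : ∀ k → tilings (square₀ ∷ upper) (remove vert₀ U) k ≡ 0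
        after-vert₀ k =
          trans (tilings-skips (square₀ ∷ horiz₁ ∷ vert₁ ∷ square₁ ∷ []) ts V k
                  (  fits-false square₀ V (here refl) (remove-covered vert₀ c00 U (here refl))
                   ∷ fits-false horiz₁ V (here refl) c01-covered ∷ fits-false vert₁ V (here refl) c01-covered
                   ∷ fits-false square₁ V (here refl) c01-covered ∷ []))
            (tilings-uncoverable ts V c10 (remove-keeps vert₀ c10 U c10∈ (c10≢c0 ∷ c10≢c0 ∷ [])) c10-unreached k)
          where
          V : List Cell
          V = remove vert₀ U
          c01-covered : c01 ∈ᵇ V ≡ false
          c01-covered = remove-covered vert₀ c01 U (there (here refl))

        without-horiz₀ : ∀ k → tilings (vert₀ ∷ square₀ ∷ upper) U k ≡ shift (tilings ts (remove square₀ U)) k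
        without-horiz₀ k =
          trans (tilings-place vert₀ (square₀ ∷ upper) U k
                  (fits-true vert₀ U λ { _ (here refl) → c00∈ ; _ (there (here refl)) → c01∈ }))
            (trans (cong₂ _+_ (with-square₀ k) (after-vert₀ k)) (ℕP.+-identityʳ _))

        with-horiz₀ : ∀ k → tilings (vert₀ ∷ square₀ ∷ upper) (remove horiz₀ U) k ≡
                            tilings ts (remove horiz₁ (remove horiz₀ U)) k
        with-horiz₀ k =
          trans (tilings-skips (vert₀ ∷ square₀ ∷ []) upper V k
                  (fits-false vert₀ V (here refl) c00-covered ∷ fits-false square₀ V (here refl) c00-covered ∷ []))
          (trans (tilings-place horiz₁ (vert₁ ∷ square₁ ∷ ts) V k (fits-horiz₁ V c01∈V c11∈V))
            (cong₂ _+_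
              (trans (skip-vert₁-square₁ ts V k c02∉V) (tilings-uncoverable ts V c11 c11∈V c11-unreached k))
              (skip-vert₁-square₁ ts (remove horiz₁ V) k (remove-absent horiz₁ c02 V c02∉V))))
          where
          V : List Cell
          V = remove horiz₀ U
          c00-covered : c00 ∈ᵇ V ≡ false
          c00-covered = remove-covered horiz₀ c00 U (here refl)
          c01∈V : c01 ∈ᵇ V ≡ true
          c01∈V = remove-keeps horiz₀ c01 U c01∈ ((λ ()) ∷ (λ e → c10≢c0 (sym e)) ∷ [])
          c11∈V : c11 ∈ᵇ V ≡ true
          c11∈V = remove-keeps horiz₀ c11 U c11∈ (c10≢c0 ∷ (λ ()) ∷ [])
          c02∉V : c02 ∈ᵇ V ≡ false
          c02∉V = remove-absent horiz₀ c02 U c02∉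

      tilings-column-full : ∀ k → tilings (column j ++ ts) U k ≡
                            tilings ts (remove horiz₁ (remove horiz₀ U)) k + shift (tilings ts (remove square₀ U)) k
      tilings-column-full k =
        trans (tilings-place horiz₀ (vert₀ ∷ square₀ ∷ upper) U k
                (fits-true horiz₀ U λ { _ (here refl) → c00∈ ; _ (there (here refl)) → c10∈ }))
          (trans (cong₂ _+_ (without-horiz₀ k) (with-horiz₀ k))
            (ℕP.+-comm (shift (tilings ts (remove square₀ U)) k) _))

  module Pendant (j : ℕ) where

    p₀ p₁ p₁' p₂ a₀ a₁ a₁' : Cell
    p₀  = (+ j , -1ℤ)
    p₁  = (+ suc j , -1ℤ)
    p₁' = (+ (j + 1) , -1ℤ)
    p₂  = (+ (suc j + 1) , -1ℤ)
    a₀  = (+ j , + 0)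
    a₁  = (+ suc j , + 0)
    a₁' = (+ (j + 1) , + 0)

    horizP₀ vertP₀ squareP₀ horizP₁ vertP₁ squareP₁ : Tile
    horizP₀  = (p₀ , horiz)
    vertP₀   = (p₀ , vert)
    squareP₀ = (p₀ , square)
    horizP₁  = (p₁ , horiz)
    vertP₁   = (p₁ , vert)
    squareP₁ = (p₁ , square)

    -- tileCells writes the column after j as j + 1, the ladder as suc j.
    p₁≡p₁' : p₁ ≡ p₁'
    p₁≡p₁' = cong (λ m → (+ m , -1ℤ)) (ℕP.+-comm 1 j)

    a₁≡a₁' : a₁ ≡ a₁'
    a₁≡a₁' = cong (λ m → (+ m , + 0)) (ℕP.+-comm 1 j)

    skip-squareP₁ : ∀ ts V k → p₂ ∈ᵇ V ≡ false → tilings (squareP₁ ∷ ts) V k ≡ tilings ts V k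
    skip-squareP₁ ts V k p₂∉ = tilings-skip squareP₁ ts V k (fits-false squareP₁ V (there (here refl)) p₂∉)

    module _ (ts : List Tile) (U : List Cell)
             (p₀∈ : p₀ ∈ᵇ U ≡ true) (p₁∈ : p₁ ∈ᵇ U ≡ true)
             (a₀∈ : a₀ ∈ᵇ U ≡ true) (a₁∈ : a₁ ∈ᵇ U ≡ true)
             (p₂∉ : p₂ ∈ᵇ U ≡ false)
             (p₀-unreached : All (λ t → p₀ ∈ᵇ tileCells t ≡ false) ts)
             (p₁-unreached : All (λ t → p₁ ∈ᵇ tileCells t ≡ false) ts) where

      private
        right : List Tile
        right = horizP₁ ∷ vertP₁ ∷ squareP₁ ∷ ts

        p₁'∈ : p₁' ∈ᵇ U ≡ true
        p₁'∈ = subst (λ c → c ∈ᵇ U ≡ true) p₁≡p₁' p₁∈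

        a₁'∈ : a₁' ∈ᵇ U ≡ true
        a₁'∈ = subst (λ c → c ∈ᵇ U ≡ true) a₁≡a₁' a₁∈

        p₀-uncovered : ∀ k → tilings right U k ≡ 0
        p₀-uncovered k =
          trans (tilings-skip horizP₁ (vertP₁ ∷ squareP₁ ∷ ts) U k (fits-false horizP₁ U (there (here refl)) p₂∉))
          (trans (tilings-place vertP₁ (squareP₁ ∷ ts) U k
                   (fits-true vertP₁ U λ { _ (here refl) → p₁∈ ; _ (there (here refl)) → a₁∈ }))
            (cong₂ _+_
              (trans (skip-squareP₁ ts U k p₂∉) (tilings-uncoverable ts U p₀ p₀∈ p₀-unreached k))
              (trans (skip-squareP₁ ts (remove vertP₁ U) k (remove-absent vertP₁ p₂ U p₂∉))
                (tilings-uncoverable ts (remove vertP₁ U) p₀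
                  (remove-keeps vertP₁ p₀ U p₀∈ ((λ ()) ∷ (λ ()) ∷ [])) p₀-unreached k))))

        after-squareP₀ : ∀ k → tilings right (remove squareP₀ U) k ≡ tilings ts (remove squareP₀ U) k
        after-squareP₀ k =
          trans (tilings-skips (horizP₁ ∷ vertP₁ ∷ []) (squareP₁ ∷ ts) V k
                  (  fits-false horizP₁ V (there (here refl)) (remove-absent squareP₀ p₂ U p₂∉)
                   ∷ fits-false vertP₁ V (here refl) (remove-covered squareP₀ p₁ U (there (here p₁≡p₁'))) ∷ []))
            (skip-squareP₁ ts V k (remove-absent squareP₀ p₂ U p₂∉))
          where
          V : List Cell
          V = remove squareP₀ U

        with-squareP₀ : ∀ k → tilings (squareP₀ ∷ right) U k ≡ shift (tilings ts (remove squareP₀ U)) k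
        with-squareP₀ k =
          trans (tilings-place squareP₀ right U k
                  (fits-true squareP₀ U λ { _ (here refl) → p₀∈ ; _ (there (here refl)) → p₁'∈
                                          ; _ (there (there (here refl))) → a₀∈
                                          ; _ (there (there (there (here refl)))) → a₁'∈ }))
            (cong₂ _+_ (p₀-uncovered k) (squareShift-cong squareP₀ _ _ after-squareP₀ k))

        after-vertP₀ : ∀ k → tilings (squareP₀ ∷ right) (remove vertP₀ U) k ≡
                             tilings ts (remove vertP₁ (remove vertP₀ U)) k
        after-vertP₀ k =
          trans (tilings-skips (squareP₀ ∷ horizP₁ ∷ []) (vertP₁ ∷ squareP₁ ∷ ts) V k
                  (  fits-false squareP₀ V (here refl) (remove-covered vertP₀ p₀ U (here refl))
                   ∷ fits-false horizP₁ V (there (here refl)) p₂∉V ∷ []))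
          (trans (tilings-place vertP₁ (squareP₁ ∷ ts) V k
                   (fits-true vertP₁ V λ { _ (here refl) → p₁∈V ; _ (there (here refl)) → a₁∈V }))
            (cong₂ _+_
              (trans (skip-squareP₁ ts V k p₂∉V) (tilings-uncoverable ts V p₁ p₁∈V p₁-unreached k))
              (skip-squareP₁ ts (remove vertP₁ V) k (remove-absent vertP₁ p₂ V p₂∉V))))
          where
          V : List Cell
          V = remove vertP₀ U
          p₂∉V : p₂ ∈ᵇ V ≡ false
          p₂∉V = remove-absent vertP₀ p₂ U p₂∉
          p₁∈V : p₁ ∈ᵇ V ≡ true
          p₁∈V = remove-keeps vertP₀ p₁ U p₁∈ ((λ ()) ∷ (λ ()) ∷ [])
          a₁∈V : a₁ ∈ᵇ V ≡ true
          a₁∈V = remove-keeps vertP₀ a₁ U a₁∈ ((λ ()) ∷ (λ ()) ∷ [])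

        without-horizP₀ : ∀ k → tilings (vertP₀ ∷ squareP₀ ∷ right) U k ≡
                          shift (tilings ts (remove squareP₀ U)) k + tilings ts (remove vertP₁ (remove vertP₀ U)) k
        without-horizP₀ k =
          trans (tilings-place vertP₀ (squareP₀ ∷ right) U k
                  (fits-true vertP₀ U λ { _ (here refl) → p₀∈ ; _ (there (here refl)) → a₀∈ }))
            (cong₂ _+_ (with-squareP₀ k) (after-vertP₀ k))

        with-horizP₀ : ∀ k → tilings (vertP₀ ∷ squareP₀ ∷ right) (remove horizP₀ U) k ≡
                             tilings ts (remove horizP₀ U) k
        with-horizP₀ k = tilings-skips (vertP₀ ∷ squareP₀ ∷ horizP₁ ∷ vertP₁ ∷ squareP₁ ∷ []) ts V k
          (  fits-false vertP₀ V (here refl) p₀-covered ∷ fits-false squareP₀ V (here refl) p₀-covered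
           ∷ fits-false horizP₁ V (there (here refl)) (remove-absent horizP₀ p₂ U p₂∉)
           ∷ fits-false vertP₁ V (here refl) (remove-covered horizP₀ p₁ U (there (here p₁≡p₁')))
           ∷ fits-false squareP₁ V (there (here refl)) (remove-absent horizP₀ p₂ U p₂∉) ∷ [])
          where
          V : List Cell
          V = remove horizP₀ U
          p₀-covered : p₀ ∈ᵇ V ≡ false
          p₀-covered = remove-covered horizP₀ p₀ U (here refl)

      tilings-pendant : ∀ k → tilings (candidates (p₀ ∷ p₁ ∷ []) ++ ts) U k ≡
        tilings ts (remove horizP₀ U) k +
        (shift (tilings ts (remove squareP₀ U)) k + tilings ts (remove vertP₁ (remove vertP₀ U)) k)
      tilings-pendant k =
        trans (tilings-place horizP₀ (vertP₀ ∷ squareP₀ ∷ right) U k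
                (fits-true horizP₀ U λ { _ (here refl) → p₀∈ ; _ (there (here refl)) → p₁'∈ }))
          (trans (cong₂ _+_ (without-horizP₀ k) (with-horizP₀ k)) (ℕP.+-comm _ (tilings ts (remove horizP₀ U) k)))

  remove-from-rect : ∀ n m t → n ≤ m →
    (∀ a b → a ≤ m → b ≤ 1 → (a ≤ n) ⊎ ((+ a , + b) ∈ tileCells t)) →
    (∀ a b → a ≤ n → All ((+ a , + b) ≢_) (tileCells t)) →
    remove t (rect m) ≐ᶜ rect n
  remove-from-rect n m t n≤m t-fills t-misses x = bool-ext to from
    where
    to : x ∈ᵇ remove t (rect m) ≡ true → x ∈ᵇ rect n ≡ true
    to x∈ with ∈ᵇ-remove⁻ t x (rect m) x∈
    ... | x∈rect , x∉t with ∈ᵇ-rect⁻ m x x∈rect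
    ... | a , b , refl , a≤m , b≤1 with t-fills a b a≤m b≤1
    ... | inj₁ a≤n = ∈ᵇ-rect⁺ n a b a≤n b≤1
    ... | inj₂ x∈t = ⊥-elim (∈ᵇ-∉ᵇ x (tileCells t) x∈t x∉t)
    from : x ∈ᵇ rect n ≡ true → x ∈ᵇ remove t (rect m) ≡ true
    from x∈ with ∈ᵇ-rect⁻ n x x∈
    ... | a , b , refl , a≤n , b≤1 =
      remove-keeps t x (rect m) (∈ᵇ-rect⁺ m a b (ℕP.≤-trans a≤n n≤m) b≤1) (t-misses a b a≤n)

  rect-remove-vert₀ : ∀ n → remove (Column.vert₀ (suc n)) (rect (suc n)) ≐ᶜ rect n
  rect-remove-vert₀ n = remove-from-rect n (suc n) (Column.vert₀ (suc n)) (ℕP.n≤1+n n) fills misses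
    where
    fills : ∀ a b → a ≤ suc n → b ≤ 1 → (a ≤ n) ⊎ ((+ a , + b) ∈ tileCells (Column.vert₀ (suc n)))
    fills a b a≤1+n b≤1 with ℕP.m≤n⇒m<n∨m≡n a≤1+n
    ... | inj₁ (s≤s a≤n) = inj₁ a≤n
    fills a zero          _ _        | inj₂ refl = inj₂ (here refl)
    fills a (suc zero)    _ _        | inj₂ refl = inj₂ (there (here refl))
    fills a (suc (suc b)) _ (s≤s ()) | inj₂ refl
    misses : ∀ a b → a ≤ n → All ((+ a , + b) ≢_) (tileCells (Column.vert₀ (suc n)))
    misses a b a≤n = ≢-column (ℕP.<⇒≢ (s≤s a≤n)) ∷ ≢-column (ℕP.<⇒≢ (s≤s a≤n)) ∷ []

  rect-remove-square₀ : ∀ n → remove (Column.square₀ (suc n)) (rect (suc (suc n))) ≐ᶜ rect n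
  rect-remove-square₀ n =
    remove-from-rect n (suc (suc n)) (Column.square₀ (suc n)) (ℕP.m≤n⇒m≤1+n (ℕP.n≤1+n n)) fills misses
    where
    2+n≡ : suc (suc n) ≡ suc n + 1
    2+n≡ = ℕP.+-comm 1 (suc n)
    fills : ∀ a b → a ≤ suc (suc n) → b ≤ 1 → (a ≤ n) ⊎ ((+ a , + b) ∈ tileCells (Column.square₀ (suc n)))
    fills a b a≤2+n b≤1 with ℕP.m≤n⇒m<n∨m≡n a≤2+n
    ... | inj₁ (s≤s a≤1+n) with ℕP.m≤n⇒m<n∨m≡n a≤1+n
    ...   | inj₁ (s≤s a≤n) = inj₁ a≤n
    fills a zero          _ _        | inj₁ _ | inj₂ refl = inj₂ (here refl)
    fills a (suc zero)    _ _        | inj₁ _ | inj₂ refl = inj₂ (there (there (here refl)))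
    fills a (suc (suc b)) _ (s≤s ()) | inj₁ _ | inj₂ refl
    fills a zero          _ _        | inj₂ refl = inj₂ (there (here (cong (λ m → (+ m , + 0)) 2+n≡)))
    fills a (suc zero)    _ _        | inj₂ refl = inj₂ (there (there (there (here (cong (λ m → (+ m , + 1)) 2+n≡)))))
    fills a (suc (suc b)) _ (s≤s ()) | inj₂ refl
    misses : ∀ a b → a ≤ n → All ((+ a , + b) ≢_) (tileCells (Column.square₀ (suc n)))
    misses a b a≤n = ≢-column (ℕP.<⇒≢ (s≤s a≤n)) ∷ ≢-column (ℕP.<⇒≢ a<n+2)
                   ∷ ≢-column (ℕP.<⇒≢ (s≤s a≤n)) ∷ ≢-column (ℕP.<⇒≢ a<n+2) ∷ []
      where
      a<n+2 : a < suc n + 1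
      a<n+2 = subst (a <_) 2+n≡ (ℕP.m<n⇒m<1+n (s≤s a≤n))

  remove-horiz₁-horiz₀ : ∀ j U →
    remove (Column.horiz₁ j) (remove (Column.horiz₀ j) U) ≐ᶜ remove (Column.square₀ j) U
  remove-horiz₁-horiz₀ j U x
    rewrite ∈ᵇ-remove (Column.horiz₁ j) x (remove (Column.horiz₀ j) U) | ∈ᵇ-remove (Column.horiz₀ j) x U
          | ∈ᵇ-remove (Column.square₀ j) x U =
    merge (x ∈ᵇ U) (x ==ᶜ Column.c00 j) (x ==ᶜ Column.c10 j) (x ==ᶜ Column.c01 j) (x ==ᶜ Column.c11 j)
    where
    merge : ∀ u p q r s → (u ∧ not (p ∨ (q ∨ false))) ∧ not (r ∨ (s ∨ false)) ≡
                          u ∧ not (p ∨ (q ∨ (r ∨ (s ∨ false))))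
    merge false _     _     _     _     = refl
    merge true  true  _     _     _     = refl
    merge true  false true  _     _     = refl
    merge true  false false true  _     = refl
    merge true  false false false true  = refl
    merge true  false false false false = refl

  ColumnsAtMost : ℕ → Tile → Set
  ColumnsAtMost p t = ∀ c b → p < c → All ((+ c , + b) ≢_) (tileCells t)

  notched : Tile → ℕ → ℕ → ℕ
  notched t n = tilings (candidates (rect n)) (remove t (rect n))

  notched⁺ : Tile → ℕ → ℕ → ℕ
  notched⁺ t n = tilings (candidates (rect n)) (remove t (rect (suc n)))

  tilings-last-column-first : ∀ n U k →
    tilings (candidates (rect (suc n))) U k ≡ tilings (column (suc n) ++ candidates (rect n)) U k
  tilings-last-column-first n U k rewrite candidates-rect-suc n = tilings-++-comm (candidates (rect n)) (column (suc n)) U k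

  notched-∈ᵇ : ∀ {p} t → ColumnsAtMost p t → ∀ m a b → p < a → a ≤ m → b ≤ 1 →
               (+ a , + b) ∈ᵇ remove t (rect m) ≡ true
  notched-∈ᵇ t t≤p m a b p<a a≤m b≤1 =
    remove-keeps t (+ a , + b) (rect m) (∈ᵇ-rect⁺ m a b a≤m b≤1) (t≤p a b p<a)

  1+n+1≡2+n : ∀ n → suc n + 1 ≡ suc (suc n)
  1+n+1≡2+n n = ℕP.+-comm (suc n) 1

  notched-remove-vert₀ : ∀ t n → remove (Column.vert₀ (suc n)) (remove t (rect (suc n))) ≐ᶜ remove t (rect n)
  notched-remove-vert₀ t n =
    ≐ᶜ-trans (remove vert₀ (remove t (rect (suc n)))) (remove t (remove vert₀ (rect (suc n)))) (remove t (rect n))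
             (remove-comm t vert₀ (rect (suc n)))
             (remove-cong t (remove vert₀ (rect (suc n))) (rect n) (rect-remove-vert₀ n))
    where open Column (suc n)

  notched-remove-square₀ : ∀ t n →
    remove (Column.square₀ (suc n)) (remove t (rect (suc (suc n)))) ≐ᶜ remove t (rect n)
  notched-remove-square₀ t n =
    ≐ᶜ-trans (remove square₀ (remove t (rect (suc (suc n))))) (remove t (remove square₀ (rect (suc (suc n)))))
             (remove t (rect n))
             (remove-comm t square₀ (rect (suc (suc n))))
             (remove-cong t (remove square₀ (rect (suc (suc n)))) (rect n) (rect-remove-square₀ n))
    where open Column (suc n)

  notched-suc : ∀ t p → ColumnsAtMost p t → ∀ n → p ≤ n → ∀ k →
                notched t (suc n) k ≡ notched⁺ t n k + notched t n k
  notched-suc t p t≤p n p≤n k =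
    trans (tilings-last-column-first n U k)
    (trans (tilings-column-vertical (candidates (rect n)) U k c00∈ c01∈ c10∉ c11∉ c02∉)
      (cong (λ z → tilings (candidates (rect n)) U k + z)
        (tilings-cong (candidates (rect n)) (remove vert₀ U) (remove t (rect n)) (notched-remove-vert₀ t n) k)))
    where
    open Column (suc n)
    U : List Cell
    U = remove t (rect (suc n))
    c00∈ : c00 ∈ᵇ U ≡ true
    c00∈ = notched-∈ᵇ t t≤p (suc n) (suc n) 0 (s≤s p≤n) ℕP.≤-refl z≤n
    c01∈ : c01 ∈ᵇ U ≡ true
    c01∈ = notched-∈ᵇ t t≤p (suc n) (suc n) 1 (s≤s p≤n) ℕP.≤-refl (s≤s z≤n)
    beyond : suc n < suc n + 1
    beyond = ℕP.m<m+n (suc n) (s≤s z≤n)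
    c10∉ : c10 ∈ᵇ U ≡ false
    c10∉ = remove-absent t c10 (rect (suc n)) (∉ᵇ-rect-beyond (suc n) (suc n + 1) (+ 0) beyond)
    c11∉ : c11 ∈ᵇ U ≡ false
    c11∉ = remove-absent t c11 (rect (suc n)) (∉ᵇ-rect-beyond (suc n) (suc n + 1) (+ 1) beyond)
    c02∉ : c02 ∈ᵇ U ≡ false
    c02∉ = remove-absent t c02 (rect (suc n)) (∉ᵇ-rect-row₂ (suc n) (suc n))

  notched⁺-suc : ∀ t p → ColumnsAtMost p t → ∀ n → p ≤ n → ∀ k →
                 notched⁺ t (suc n) k ≡ notched t n k + shift (notched t n) k
  notched⁺-suc t p t≤p n p≤n k =
    trans (tilings-last-column-first n U k)
    (trans (tilings-column-full (candidates (rect n)) U c00∈ c01∈ c10∈ c11∈ c02∉ c10-unreached c11-unreached k)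
      (cong₂ _+_
        (tilings-cong (candidates (rect n)) (remove horiz₁ (remove horiz₀ U)) (remove t (rect n))
          (≐ᶜ-trans (remove horiz₁ (remove horiz₀ U)) (remove square₀ U) (remove t (rect n))
                    (remove-horiz₁-horiz₀ (suc n) U) (notched-remove-square₀ t n)) k)
        (shift-cong _ _ (tilings-cong (candidates (rect n)) (remove square₀ U) (remove t (rect n))
                                      (notched-remove-square₀ t n)) k)))
    where
    open Column (suc n)
    U : List Cell
    U = remove t (rect (suc (suc n)))
    p<1+n : p < suc n
    p<1+n = s≤s p≤n
    p<n+2 : p < suc n + 1
    p<n+2 = ℕP.<-trans p<1+n (ℕP.m<m+n (suc n) (s≤s z≤n))
    n+2≤ : suc n + 1 ≤ suc (suc n)
    n+2≤ = ℕP.≤-reflexive (1+n+1≡2+n n)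
    c00∈ : c00 ∈ᵇ U ≡ true
    c00∈ = notched-∈ᵇ t t≤p (suc (suc n)) (suc n) 0 p<1+n (ℕP.n≤1+n _) z≤n
    c01∈ : c01 ∈ᵇ U ≡ true
    c01∈ = notched-∈ᵇ t t≤p (suc (suc n)) (suc n) 1 p<1+n (ℕP.n≤1+n _) (s≤s z≤n)
    c10∈ : c10 ∈ᵇ U ≡ true
    c10∈ = notched-∈ᵇ t t≤p (suc (suc n)) (suc n + 1) 0 p<n+2 n+2≤ z≤n
    c11∈ : c11 ∈ᵇ U ≡ true
    c11∈ = notched-∈ᵇ t t≤p (suc (suc n)) (suc n + 1) 1 p<n+2 n+2≤ (s≤s z≤n)
    c02∉ : c02 ∈ᵇ U ≡ false
    c02∉ = remove-absent t c02 (rect (suc (suc n))) (∉ᵇ-rect-row₂ (suc (suc n)) (suc n))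
    c10-unreached : All (λ t → c10 ∈ᵇ tileCells t ≡ false) (candidates (rect n))
    c10-unreached = candidates-miss-column n (+ 0)
    c11-unreached : All (λ t → c11 ∈ᵇ tileCells t ≡ false) (candidates (rect n))
    c11-unreached = candidates-miss-column n (+ 1)

  δ₀ : ℕ → ℕ
  δ₀ zero    = 1
  δ₀ (suc k) = 0

  -- Removing farTile removes nothing; it lets rect n share the recurrences notched-suc and notched⁺-suc.
  farTile : Tile
  farTile = ((+ 0 , -1ℤ) , horiz)

  farTile-columnsAtMost : ColumnsAtMost 0 farTile
  farTile-columnsAtMost _ _ _ = (λ ()) ∷ (λ ()) ∷ []

  remove-farTile : ∀ n → remove farTile (rect n) ≐ᶜ rect n
  remove-farTile n x = bool-ext (proj₁ ∘ ∈ᵇ-remove⁻ farTile x (rect n)) kept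
    where
    kept : x ∈ᵇ rect n ≡ true → x ∈ᵇ remove farTile (rect n) ≡ true
    kept x∈ with ∈ᵇ-rect⁻ n x x∈
    ... | _ , _ , refl , _ = remove-keeps farTile x (rect n) x∈ ((λ ()) ∷ (λ ()) ∷ [])

  f≡notched-farTile : ∀ n k → f (rect n) k ≡ notched farTile n k
  f≡notched-farTile n k =
    trans (f≡tilings (rect n) k)
          (tilings-cong (candidates (rect n)) (rect n) (remove farTile (rect n)) (λ x → sym (remove-farTile n x)) k)

  notched-farTile-zero : ∀ k → notched farTile 0 k ≡ δ₀ k
  notched-farTile-zero zero    = refl
  notched-farTile-zero (suc k) = refl

  notched⁺-farTile-zero : ∀ k → notched⁺ farTile 0 k ≡ δ₀ k + shift δ₀ k
  notched⁺-farTile-zero zero          = refl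
  notched⁺-farTile-zero (suc zero)    = refl
  notched⁺-farTile-zero (suc (suc k)) = refl

  notched-farTile-suc : ∀ n k → notched farTile (suc n) k ≡ notched⁺ farTile n k + notched farTile n k
  notched-farTile-suc n = notched-suc farTile 0 farTile-columnsAtMost n z≤n

  notched⁺-farTile-suc : ∀ n k → notched⁺ farTile (suc n) k ≡ notched farTile n k + shift (notched farTile n) k
  notched⁺-farTile-suc n = notched⁺-suc farTile 0 farTile-columnsAtMost n z≤n

  slot : ℕ → Tile
  slot j = ((+ j , + 0) , horiz)

  slot-columnsAtMost : ∀ j → ColumnsAtMost (suc j) (slot j)
  slot-columnsAtMost j c b 1+j<c =
    ≢-column (λ c≡j → ℕP.<⇒≢ (ℕP.<-trans (ℕP.n<1+n j) 1+j<c) (sym c≡j))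
    ∷ ≢-column (λ c≡j+1 → ℕP.<⇒≢ 1+j<c (trans (ℕP.+-comm 1 j) (sym c≡j+1))) ∷ []

  leftOfSlot : ℕ → ℕ → ℕ
  leftOfSlot zero    = δ₀
  leftOfSlot (suc m) = notched farTile m

  slot-covers-c10 : ∀ j → (+ suc j , + 0) ∈ tileCells (slot j)
  slot-covers-c10 j = there (here (cong (λ m → (+ m , + 0)) (ℕP.+-comm 1 j)))

  tilings-left-of-slot : ∀ j k → tilings (candidates (rect j)) (remove (slot j) (rect (suc j))) k ≡ leftOfSlot j k
  tilings-left-of-slot zero zero    = refl
  tilings-left-of-slot zero (suc k) = refl
  tilings-left-of-slot (suc j) k =
    trans (tilings-last-column-first j V k)
    (trans (tilings-column-upper (candidates (rect j)) V k c00∉ c01∈ c11∈ c02∉)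
      (cong₂ _+_
        (tilings-uncoverable (candidates (rect j)) V c11 c11∈ c11-unreached k)
        (tilings-cong (candidates (rect j)) (remove horiz₁ V) (remove farTile (rect j))
          (≐ᶜ-trans (remove horiz₁ V) (remove square₀ (rect (suc (suc j)))) (remove farTile (rect j))
             (remove-horiz₁-horiz₀ (suc j) (rect (suc (suc j))))
             (≐ᶜ-trans (remove square₀ (rect (suc (suc j)))) (rect j) (remove farTile (rect j))
                (rect-remove-square₀ j) (λ x → sym (remove-farTile j x)))) k)))
    where
    open Column (suc j)
    V : List Cell
    V = remove (slot (suc j)) (rect (suc (suc j)))
    c00∉ : c00 ∈ᵇ V ≡ false
    c00∉ = remove-covered (slot (suc j)) c00 (rect (suc (suc j))) (here refl)
    c01∈ : c01 ∈ᵇ V ≡ true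
    c01∈ = remove-keeps (slot (suc j)) c01 (rect (suc (suc j)))
             (∈ᵇ-rect⁺ (suc (suc j)) (suc j) 1 (ℕP.n≤1+n _) (s≤s z≤n)) ((λ ()) ∷ (λ ()) ∷ [])
    c11∈ : c11 ∈ᵇ V ≡ true
    c11∈ = remove-keeps (slot (suc j)) c11 (rect (suc (suc j)))
             (∈ᵇ-rect⁺ (suc (suc j)) (suc j + 1) 1 (ℕP.≤-reflexive (1+n+1≡2+n j)) (s≤s z≤n))
             ((λ ()) ∷ (λ ()) ∷ [])
    c02∉ : c02 ∈ᵇ V ≡ false
    c02∉ = remove-absent (slot (suc j)) c02 (rect (suc (suc j))) (∉ᵇ-rect-row₂ (suc (suc j)) (suc j))
    c11-unreached : All (λ t → c11 ∈ᵇ tileCells t ≡ false) (candidates (rect j))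
    c11-unreached = candidates-miss-column j (+ 1)

  notched-slot-base : ∀ j k → notched (slot j) (suc j) k ≡ leftOfSlot j k
  notched-slot-base j k =
    trans (tilings-last-column-first j U k)
    (trans (tilings-column-unusable (candidates (rect j)) U k c00∉ c11∉ c02∉) (tilings-left-of-slot j k))
    where
    open Column (suc j)
    U : List Cell
    U = remove (slot j) (rect (suc j))
    c00∉ : c00 ∈ᵇ U ≡ false
    c00∉ = remove-covered (slot j) c00 (rect (suc j)) (slot-covers-c10 j)
    c11∉ : c11 ∈ᵇ U ≡ false
    c11∉ = remove-absent (slot j) c11 (rect (suc j))
             (∉ᵇ-rect-beyond (suc j) (suc j + 1) (+ 1) (ℕP.m<m+n (suc j) (s≤s z≤n)))
    c02∉ : c02 ∈ᵇ U ≡ false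
    c02∉ = remove-absent (slot j) c02 (rect (suc j)) (∉ᵇ-rect-row₂ (suc j) (suc j))

  notched⁺-slot-base : ∀ j k → notched⁺ (slot j) (suc j) k ≡ 0
  notched⁺-slot-base j k =
    trans (tilings-last-column-first j U k)
    (trans (tilings-column-upper (candidates (rect j)) U k c00∉ c01∈ c11∈ c02∉)
      (cong₂ _+_ (tilings-uncoverable (candidates (rect j)) U c10 c10∈ c10-unreached k)
                 (tilings-uncoverable (candidates (rect j)) (remove horiz₁ U) c10
                    (remove-keeps horiz₁ c10 U c10∈ ((λ ()) ∷ (λ ()) ∷ [])) c10-unreached k)))
    where
    open Column (suc j)
    U : List Cell
    U = remove (slot j) (rect (suc (suc j)))
    c10∈ : c10 ∈ᵇ U ≡ true
    c10∈ = notched-∈ᵇ (slot j) (slot-columnsAtMost j) (suc (suc j)) (suc j + 1) 0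
             (ℕP.m<m+n (suc j) (s≤s z≤n)) (ℕP.≤-reflexive (1+n+1≡2+n j)) z≤n
    c10-unreached : All (λ t → c10 ∈ᵇ tileCells t ≡ false) (candidates (rect j))
    c10-unreached = candidates-miss-column j (+ 0)
    c00∉ : c00 ∈ᵇ U ≡ false
    c00∉ = remove-covered (slot j) c00 (rect (suc (suc j))) (slot-covers-c10 j)
    c01∈ : c01 ∈ᵇ U ≡ true
    c01∈ = remove-keeps (slot j) c01 (rect (suc (suc j)))
             (∈ᵇ-rect⁺ (suc (suc j)) (suc j) 1 (ℕP.n≤1+n _) (s≤s z≤n)) ((λ ()) ∷ (λ ()) ∷ [])
    c11∈ : c11 ∈ᵇ U ≡ true
    c11∈ = notched-∈ᵇ (slot j) (slot-columnsAtMost j) (suc (suc j)) (suc j + 1) 1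
             (ℕP.m<m+n (suc j) (s≤s z≤n)) (ℕP.≤-reflexive (1+n+1≡2+n j)) (s≤s z≤n)
    c02∉ : c02 ∈ᵇ U ≡ false
    c02∉ = remove-absent (slot j) c02 (rect (suc (suc j))) (∉ᵇ-rect-row₂ (suc (suc j)) (suc j))

  remove≐remove : ∀ (L R : List Cell) (t u : Tile) →
    (∀ x → x ∈ᵇ L ≡ true → x ∈ᵇ tileCells t ≡ false →
           (x ∈ᵇ R ≡ true) × (x ∈ᵇ tileCells u ≡ false)) →
    (∀ x → x ∈ᵇ R ≡ true → x ∈ᵇ tileCells u ≡ false →
           (x ∈ᵇ L ≡ true) × (x ∈ᵇ tileCells t ≡ false)) →
     remove t L ≐ᶜ remove u R
  remove≐remove L R t u to from x = bool-ext
    (λ x∈ → let (x∈L , x∉t) = ∈ᵇ-remove⁻ t x L x∈ ; (x∈R , x∉u) = to x x∈L x∉t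
            in remove-keepsᵇ u x R x∈R x∉u)
    (λ x∈ → let (x∈R , x∉u) = ∈ᵇ-remove⁻ u x R x∈ ; (x∈L , x∉t) = from x x∈R x∉u
            in remove-keepsᵇ t x L x∈L x∉t)

  module LadderRegion (n j : ℕ) (j<n : j < n) where

    open Pendant j

    L : List Cell
    L = rect n ++ (p₀ ∷ p₁ ∷ [])

    ∈ᵇ-ladder⁻ : ∀ x → x ∈ᵇ L ≡ true → (x ∈ rect n) ⊎ ((x ≡ p₀) ⊎ (x ≡ p₁))
    ∈ᵇ-ladder⁻ x x∈ with ∈-++⁻ (rect n) (∈ᵇ-sound x L x∈)
    ... | inj₁ x∈rect             = inj₁ x∈rect
    ... | inj₂ (here x≡p₀)        = inj₂ (inj₁ x≡p₀)
    ... | inj₂ (there (here x≡p₁)) = inj₂ (inj₂ x≡p₁)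

    rect⊆L : ∀ {x} → x ∈ rect n → x ∈ᵇ L ≡ true
    rect⊆L x∈ = ∈ᵇ-complete (∈-++⁺ˡ x∈)

    after-horizP₀ : remove horizP₀ L ≐ᶜ remove farTile (rect n)
    after-horizP₀ = remove≐remove L (rect n) horizP₀ farTile to from
      where
      to : ∀ x → x ∈ᵇ L ≡ true → x ∈ᵇ tileCells horizP₀ ≡ false →
           (x ∈ᵇ rect n ≡ true) × (x ∈ᵇ tileCells farTile ≡ false)
      to x x∈L x∉h with ∈ᵇ-ladder⁻ x x∈L
      ... | inj₁ x∈rect with ∈-rect⁻ n x x∈rect
      ...   | _ , _ , refl , _ = ∈ᵇ-complete x∈rect , ∉ᵇ x (tileCells farTile) (λ { (here ()) ; (there (here ())) })
      to x x∈L x∉h | inj₂ (inj₁ refl) = ⊥-elim (∈ᵇ-∉ᵇ p₀ (tileCells horizP₀) (here refl) x∉h)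
      to x x∈L x∉h | inj₂ (inj₂ refl) = ⊥-elim (∈ᵇ-∉ᵇ p₁ (tileCells horizP₀) (there (here p₁≡p₁')) x∉h)
      from : ∀ x → x ∈ᵇ rect n ≡ true → x ∈ᵇ tileCells farTile ≡ false →
             (x ∈ᵇ L ≡ true) × (x ∈ᵇ tileCells horizP₀ ≡ false)
      from x x∈R _ with ∈ᵇ-rect⁻ n x x∈R
      ... | _ , _ , refl , _ =
        rect⊆L (∈ᵇ-sound x (rect n) x∈R) , ∉ᵇ x (tileCells horizP₀) (λ { (here ()) ; (there (here ())) })

    after-squareP₀ : remove squareP₀ L ≐ᶜ remove (slot j) (rect n)
    after-squareP₀ = remove≐remove L (rect n) squareP₀ (slot j) to from
      where
      to : ∀ x → x ∈ᵇ L ≡ true → x ∈ᵇ tileCells squareP₀ ≡ false →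
           (x ∈ᵇ rect n ≡ true) × (x ∈ᵇ tileCells (slot j) ≡ false)
      to x x∈L x∉s with ∈ᵇ-ladder⁻ x x∈L
      ... | inj₁ x∈rect      = ∈ᵇ-complete x∈rect ,
            ∉ᵇ x (tileCells (slot j)) (λ x∈slot → ∈ᵇ-∉ᵇ x (tileCells squareP₀) (there (there x∈slot)) x∉s)
      ... | inj₂ (inj₁ refl) = ⊥-elim (∈ᵇ-∉ᵇ p₀ (tileCells squareP₀) (here refl) x∉s)
      ... | inj₂ (inj₂ refl) = ⊥-elim (∈ᵇ-∉ᵇ p₁ (tileCells squareP₀) (there (here p₁≡p₁')) x∉s)
      from : ∀ x → x ∈ᵇ rect n ≡ true → x ∈ᵇ tileCells (slot j) ≡ false →
             (x ∈ᵇ L ≡ true) × (x ∈ᵇ tileCells squareP₀ ≡ false)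
      from x x∈R x∉slot with ∈ᵇ-rect⁻ n x x∈R
      ... | _ , _ , refl , _ =
        rect⊆L (∈ᵇ-sound x (rect n) x∈R) ,
        ∉ᵇ x (tileCells squareP₀)
          (λ { (here ()) ; (there (here ())) ; (there (there x∈slot)) → ∈ᵇ-∉ᵇ x (tileCells (slot j)) x∈slot x∉slot })

    after-vertP₀-vertP₁ : remove vertP₁ (remove vertP₀ L) ≐ᶜ remove (slot j) (rect n)
    after-vertP₀-vertP₁ = remove≐remove (remove vertP₀ L) (rect n) vertP₁ (slot j) to from
      where
      to : ∀ x → x ∈ᵇ remove vertP₀ L ≡ true → x ∈ᵇ tileCells vertP₁ ≡ false →
           (x ∈ᵇ rect n ≡ true) × (x ∈ᵇ tileCells (slot j) ≡ false)
      to x x∈ x∉v₁ with ∈ᵇ-remove⁻ vertP₀ x L x∈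
      ... | x∈L , x∉v₀ with ∈ᵇ-ladder⁻ x x∈L
      ... | inj₁ x∈rect = ∈ᵇ-complete x∈rect ,
            ∉ᵇ x (tileCells (slot j))
              (λ { (here refl)         → ∈ᵇ-∉ᵇ a₀ (tileCells vertP₀) (there (here refl)) x∉v₀
                 ; (there (here refl)) → ∈ᵇ-∉ᵇ a₁' (tileCells vertP₁) (there (here (sym a₁≡a₁'))) x∉v₁ })
      ... | inj₂ (inj₁ refl) = ⊥-elim (∈ᵇ-∉ᵇ p₀ (tileCells vertP₀) (here refl) x∉v₀)
      ... | inj₂ (inj₂ refl) = ⊥-elim (∈ᵇ-∉ᵇ p₁ (tileCells vertP₁) (here refl) x∉v₁)
      from : ∀ x → x ∈ᵇ rect n ≡ true → x ∈ᵇ tileCells (slot j) ≡ false →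
             (x ∈ᵇ remove vertP₀ L ≡ true) × (x ∈ᵇ tileCells vertP₁ ≡ false)
      from x x∈R x∉slot with ∈ᵇ-rect⁻ n x x∈R
      ... | _ , _ , refl , _ =
        remove-keepsᵇ vertP₀ x L (rect⊆L (∈ᵇ-sound x (rect n) x∈R))
          (∉ᵇ x (tileCells vertP₀)
            (λ { (here ()) ; (there (here refl)) → ∈ᵇ-∉ᵇ a₀ (tileCells (slot j)) (here refl) x∉slot })) ,
        ∉ᵇ x (tileCells vertP₁)
          (λ { (here ()) ; (there (here refl)) → ∈ᵇ-∉ᵇ a₁ (tileCells (slot j)) (there (here a₁≡a₁')) x∉slot })

    f-ladder : ∀ k → f (ladder n (suc j)) k ≡ notched farTile n k + (shift (notched (slot j) n) k + notched (slot j) n k)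
    f-ladder k =
      trans (f≡tilings L k)
      (trans (cong (λ ts → tilings ts L k) (candidates-++ (rect n) (p₀ ∷ p₁ ∷ [])))
      (trans (tilings-++-comm (candidates (rect n)) (candidates (p₀ ∷ p₁ ∷ [])) L k)
      (trans (tilings-pendant ts L p₀∈ p₁∈ a₀∈ a₁∈ p₂∉
                (candidates-miss-row₋₁ n j) (candidates-miss-row₋₁ n (suc j)) k)
        (cong₂ _+_ (tilings-cong ts _ _ after-horizP₀ k)
          (cong₂ _+_ (shift-cong _ _ (tilings-cong ts _ _ after-squareP₀) k)
                     (tilings-cong ts _ _ after-vertP₀-vertP₁ k))))))
      where
      ts : List Tile
      ts = candidates (rect n)
      p₀∈ : p₀ ∈ᵇ L ≡ true
      p₀∈ = ∈ᵇ-complete (∈-++⁺ʳ (rect n) (here refl))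
      p₁∈ : p₁ ∈ᵇ L ≡ true
      p₁∈ = ∈ᵇ-complete (∈-++⁺ʳ (rect n) (there (here refl)))
      a₀∈ : a₀ ∈ᵇ L ≡ true
      a₀∈ = rect⊆L (∈-rect⁺ n j 0 (ℕP.<⇒≤ j<n) z≤n)
      a₁∈ : a₁ ∈ᵇ L ≡ true
      a₁∈ = rect⊆L (∈-rect⁺ n (suc j) 0 j<n z≤n)
      p₂∉ : p₂ ∈ᵇ L ≡ false
      p₂∉ = ∉ᵇ p₂ L λ p₂∈ → case ∈-++⁻ (rect n) p₂∈ of λ
        { (inj₁ p₂∈rect) → case ∈-rect⁻ n p₂ p₂∈rect of λ { (_ , _ , () , _) }
        ; (inj₂ (here p₂≡p₀)) → ℕP.m+1+n≢m j {1} (trans (ℕP.+-suc j 1) (ℤP.+-injective (cong proj₁ p₂≡p₀)))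
        ; (inj₂ (there (here p₂≡p₁))) → ℕP.m+1+n≢m (suc j) {0} (ℤP.+-injective (cong proj₁ p₂≡p₁)) }

module FiniteSums {c ℓ} (R : CommutativeRing c ℓ) where

  open CommutativeRing R renaming (refl to ≈-refl; sym to ≈-sym; trans to ≈-trans)
  open import Algebra.Properties.Ring ring using (-‿+-comm; -0#≈0#)
  open import Algebra.Properties.CommutativeSemigroup +-commutativeSemigroup using (interchange)
  open import Relation.Binary.Reasoning.Setoid setoid

  ∑< : ℕ → (ℕ → Carrier) → Carrier
  ∑< zero    g = 0#
  ∑< (suc n) g = ∑< n g + g n

  ∑<-cong : ∀ n {g h : ℕ → Carrier} → (∀ j → j < n → g j ≈ h j) → ∑< n g ≈ ∑< n h
  ∑<-cong zero    g≈h = ≈-refl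
  ∑<-cong (suc n) g≈h = +-cong (∑<-cong n (λ j j<n → g≈h j (ℕP.m<n⇒m<1+n j<n))) (g≈h n ℕP.≤-refl)

  ∑<-zero : ∀ n {g : ℕ → Carrier} → (∀ j → j < n → g j ≈ 0#) → ∑< n g ≈ 0#
  ∑<-zero zero    g≈0 = ≈-refl
  ∑<-zero (suc n) g≈0 =
    ≈-trans (+-cong (∑<-zero n (λ j j<n → g≈0 j (ℕP.m<n⇒m<1+n j<n))) (g≈0 n ℕP.≤-refl)) (+-identityˡ 0#)

  ∑<-+ : ∀ n (g h : ℕ → Carrier) → ∑< n (λ j → g j + h j) ≈ ∑< n g + ∑< n h
  ∑<-+ zero    g h = ≈-sym (+-identityˡ 0#)
  ∑<-+ (suc n) g h = ≈-trans (+-congʳ (∑<-+ n g h)) (interchange (∑< n g) (∑< n h) (g n) (h n))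

  ∑<-neg : ∀ n (g : ℕ → Carrier) → ∑< n (λ j → - g j) ≈ - ∑< n g
  ∑<-neg zero    g = ≈-sym -0#≈0#
  ∑<-neg (suc n) g = ≈-trans (+-congʳ (∑<-neg n g)) (-‿+-comm (∑< n g) (g n))

  ∑<-- : ∀ n (g h : ℕ → Carrier) → ∑< n (λ j → g j - h j) ≈ ∑< n g - ∑< n h
  ∑<-- n g h = ≈-trans (∑<-+ n g (λ j → - h j)) (+-congˡ (∑<-neg n h))

  ∑<-*ˡ : ∀ n x (g : ℕ → Carrier) → ∑< n (λ j → x * g j) ≈ x * ∑< n g
  ∑<-*ˡ zero    x g = ≈-sym (zeroʳ x)
  ∑<-*ˡ (suc n) x g = ≈-trans (+-congʳ (∑<-*ˡ n x g)) (≈-sym (distribˡ x (∑< n g) (g n)))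

  ∑<-*ʳ : ∀ n x (g : ℕ → Carrier) → ∑< n (λ j → g j * x) ≈ ∑< n g * x
  ∑<-*ʳ n x g = ≈-trans (∑<-cong n (λ j _ → *-comm (g j) x)) (≈-trans (∑<-*ˡ n x g) (*-comm x (∑< n g)))

  ∑<-head : ∀ n (g : ℕ → Carrier) → ∑< (suc n) g ≈ g 0 + ∑< n (g ∘ suc)
  ∑<-head zero    g = ≈-trans (+-identityˡ (g 0)) (≈-sym (+-identityʳ (g 0)))
  ∑<-head (suc n) g = ≈-trans (+-congʳ (∑<-head n g)) (+-assoc (g 0) _ _)

  ∑<-swap : ∀ n m (F : ℕ → ℕ → Carrier) → ∑< n (λ j → ∑< m (F j)) ≈ ∑< m (λ k → ∑< n (λ j → F j k))
  ∑<-swap zero    m F = ≈-sym (∑<-zero m (λ _ _ → ≈-refl))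
  ∑<-swap (suc n) m F = ≈-trans (+-congʳ (∑<-swap n m F)) (≈-sym (∑<-+ m (λ k → ∑< n (λ j → F j k)) (F n)))

  ∑<-triangle : ∀ N (F : ℕ → ℕ → Carrier) →
    ∑< N (λ t → ∑< (suc t) (λ j → F j (t ∸ j))) ≈ ∑< N (λ j → ∑< (N ∸ j) (F j))
  ∑<-triangle zero    F = ≈-refl
  ∑<-triangle (suc N) F = begin
      ∑< N (λ t → ∑< (suc t) (λ j → F j (t ∸ j))) + ∑< (suc N) (λ j → F j (N ∸ j))
    ≈⟨ +-congʳ (∑<-triangle N F) ⟩
      ∑< N (λ j → ∑< (N ∸ j) (F j)) + (∑< N (λ j → F j (N ∸ j)) + F N (N ∸ N))
    ≈⟨ +-assoc _ _ _ ⟨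
      (∑< N (λ j → ∑< (N ∸ j) (F j)) + ∑< N (λ j → F j (N ∸ j))) + F N (N ∸ N)
    ≈⟨ +-cong (≈-sym (∑<-+ N _ _)) last ⟩
      ∑< N (λ j → ∑< (N ∸ j) (F j) + F j (N ∸ j)) + ∑< (suc N ∸ N) (F N)
    ≈⟨ +-congʳ (∑<-cong N λ j j<N → reflexive (cong (λ m → ∑< m (F j)) (ℕP.+-∸-assoc 1 (ℕP.<⇒≤ j<N)))) ⟨
      ∑< N (λ j → ∑< (suc N ∸ j) (F j)) + ∑< (suc N ∸ N) (F N)
    ∎
    where
    last : F N (N ∸ N) ≈ ∑< (suc N ∸ N) (F N)
    last = ≈-trans (reflexive (cong (F N) (ℕP.n∸n≡0 N)))
             (≈-trans (≈-sym (+-identityˡ _)) (reflexive (cong (λ m → ∑< m (F N)) (sym (ℕP.m+n∸n≡m 1 N)))))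

module IntegerPolynomials where

  open import Data.Integer using (_+_; _*_; -_; _-_; _^_)
  open FiniteSums ℤP.+-*-commutativeRing public

  xmulℤ : (ℕ → ℤ) → ℕ → ℤ
  xmulℤ p zero    = 0ℤ
  xmulℤ p (suc j) = p j

  xmulℤ-cong : ∀ p q → (∀ j → p j ≡ q j) → ∀ j → xmulℤ p j ≡ xmulℤ q j
  xmulℤ-cong p q p≗q zero    = refl
  xmulℤ-cong p q p≗q (suc j) = p≗q j

  oneℤ : ℕ → ℤ
  oneℤ zero    = 1ℤ
  oneℤ (suc _) = 0ℤ

  fibPoly : ℕ → ℕ → ℤ
  fibPoly zero          j = 0ℤ
  fibPoly (suc zero)    j = oneℤ j
  fibPoly (suc (suc m)) j = fibPoly (suc m) j + xmulℤ (fibPoly m) j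

  fibPoly-constant : ∀ k → fibPoly (suc k) 0 ≡ 1ℤ
  fibPoly-constant zero    = refl
  fibPoly-constant (suc k) rewrite fibPoly-constant k = refl

  fibPoly-degree : ∀ k j → k ≤ 2 ℕ.* j → fibPoly k j ≡ 0ℤ
  fibPoly-degree zero          j       _    = refl
  fibPoly-degree (suc zero)    (suc j) _    = refl
  fibPoly-degree (suc (suc k)) (suc j) k≤2j
    rewrite fibPoly-degree (suc k) (suc j) (ℕP.≤-trans (ℕP.n≤1+n (suc k)) k≤2j)
          | fibPoly-degree k j (ℕP.≤-pred (ℕP.≤-pred (subst (suc (suc k) ≤_) (ℕP.*-suc 2 j) k≤2j))) = refl

  _⋆_ : (ℕ → ℤ) → (ℕ → ℤ) → ℕ → ℤ
  (p ⋆ q) t = ∑< (suc t) (λ j → p j * q (t ∸ j))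

  ⋆-distribˡ-+ : ∀ p q r t → (p ⋆ (λ s → q s + r s)) t ≡ (p ⋆ q) t + (p ⋆ r) t
  ⋆-distribˡ-+ p q r t =
    trans (∑<-cong (suc t) (λ j _ → ℤP.*-distribˡ-+ (p j) (q (t ∸ j)) (r (t ∸ j)))) (∑<-+ (suc t) _ _)

  ⋆-zeroʳ : ∀ p t → (p ⋆ (λ _ → 0ℤ)) t ≡ 0ℤ
  ⋆-zeroʳ p t = ∑<-zero (suc t) (λ j _ → ℤP.*-zeroʳ (p j))

  ⋆-xmulʳ : ∀ p q t → (p ⋆ xmulℤ q) t ≡ xmulℤ (p ⋆ q) t
  ⋆-xmulʳ p q zero = trans (ℤP.+-identityˡ _) (ℤP.*-zeroʳ (p 0))
  ⋆-xmulʳ p q (suc t) =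
    trans (cong₂ _+_
            (∑<-cong (suc t) (λ j j<1+t → cong (λ s → p j * xmulℤ q s) (ℕP.+-∸-assoc 1 (ℕP.≤-pred j<1+t))))
            (cong (λ s → p (suc t) * xmulℤ q s) (ℕP.n∸n≡0 (suc t))))
    (trans (cong ((p ⋆ q) t +_) (ℤP.*-zeroʳ (p (suc t)))) (ℤP.+-identityʳ ((p ⋆ q) t)))

  ⋆-identityʳ : ∀ p t → (p ⋆ oneℤ) t ≡ p t
  ⋆-identityʳ p t =
    trans (cong₂ _+_
            (∑<-zero t (λ j j<t → trans (cong (λ s → p j * oneℤ s) (ℕP.+-∸-assoc 1 j<t)) (ℤP.*-zeroʳ (p j))))
            (cong (λ s → p t * oneℤ s) (ℕP.n∸n≡0 t)))
    (trans (ℤP.+-identityˡ _) (ℤP.*-identityʳ (p t)))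

  -- γUpTo m is the table of γ on 0 … m; γ is chosen so that Γcoeff-fibPoly-diagonal holds.
  mutual
    γUpTo : ℕ → ℕ → ℤ
    γUpTo zero    t = 1ℤ
    γUpTo (suc m) t = if does (t ℕ.≤? m) then γUpTo m t else γNext m

    γNext : ℕ → ℤ
    γNext m = (-1ℤ ^ suc m) - ∑< (suc m) (λ j → fibPoly (suc (suc (suc m))) (suc j) * γUpTo m (m ∸ j))

  γ : ℕ → ℤ
  γ m = γUpTo m m

  γUpTo-stable : ∀ m t → t ≤ m → γUpTo m t ≡ γ t
  γUpTo-stable zero    zero z≤n = refl
  γUpTo-stable (suc m) t t≤1+m with ℕP.m≤n⇒m<n∨m≡n t≤1+m
  ... | inj₁ (s≤s t≤m) rewrite dec-true (t ℕ.≤? m) t≤m = γUpTo-stable m t t≤m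
  ... | inj₂ refl = refl

  γ-suc : ∀ m → γ (suc m) ≡ (-1ℤ ^ suc m) - ∑< (suc m) (λ j → fibPoly (suc (suc (suc m))) (suc j) * γ (m ∸ j))
  γ-suc m rewrite dec-false (suc m ℕ.≤? m) (ℕP.1+n≰n {m}) =
    cong (λ s → (-1ℤ ^ suc m) - s)
      (∑<-cong (suc m) (λ j _ →
        cong (fibPoly (suc (suc (suc m))) (suc j) *_) (γUpTo-stable m (m ∸ j) (ℕP.m∸n≤m m j))))

  Γcoeff : ℕ → (ℕ → ℤ) → ℤ
  Γcoeff m q = ∑< (suc m) (λ t → q t * γ (m ∸ t))

  Γcoeff-+ : ∀ m p q → Γcoeff m (λ t → p t + q t) ≡ Γcoeff m p + Γcoeff m q
  Γcoeff-+ m p q = trans (∑<-cong (suc m) (λ t _ → ℤP.*-distribʳ-+ (γ (m ∸ t)) (p t) (q t))) (∑<-+ (suc m) _ _)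

  Γcoeff-xmul : ∀ m q → Γcoeff (suc m) (xmulℤ q) ≡ Γcoeff m q
  Γcoeff-xmul m q = trans (∑<-head (suc m) (λ t → xmulℤ q t * γ (suc m ∸ t))) (ℤP.+-identityˡ _)

  Γcoeff-⋆ : ∀ m p q → Γcoeff m (p ⋆ q) ≡ ∑< (suc m) (λ j → p j * Γcoeff (m ∸ j) q)
  Γcoeff-⋆ m p q =
    trans (∑<-cong (suc m) (λ t t<1+m → trans (sym (∑<-*ʳ (suc t) (γ (m ∸ t)) _))
             (∑<-cong (suc t) (λ j j<1+t → cong (λ s → p j * q (t ∸ j) * γ (m ∸ s))
               (sym (ℕP.m+[n∸m]≡n (ℕP.≤-pred j<1+t)))))))
    (trans (∑<-triangle (suc m) term)
     (∑<-cong (suc m) λ j j<1+m →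
       trans (cong (λ s → ∑< s (term j)) (ℕP.+-∸-assoc 1 (ℕP.≤-pred j<1+m)))
       (trans (∑<-cong (suc (m ∸ j)) (λ s _ → trans (ℤP.*-assoc (p j) (q s) _)
                                                  (cong (λ i → p j * (q s * γ i)) (sym (ℕP.∸-+-assoc m j s)))))
         (∑<-*ˡ (suc (m ∸ j)) (p j) _))))
    where
    term : ℕ → ℕ → ℤ
    term j s = p j * q s * γ (m ∸ (j ℕ.+ s))

  Γcoeff-fibPoly-diagonal : ∀ m → Γcoeff m (fibPoly (suc (suc m))) ≡ -1ℤ ^ m
  Γcoeff-fibPoly-diagonal zero    = refl
  Γcoeff-fibPoly-diagonal (suc m) = begin
      Γcoeff (suc m) Fib
    ≡⟨ ∑<-head (suc m) (λ j → Fib j * γ (suc m ∸ j)) ⟩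
      Fib 0 * γ (suc m) + rest
    ≡⟨ cong (λ a → a * γ (suc m) + rest) (fibPoly-constant (suc (suc m))) ⟩
      1ℤ * γ (suc m) + rest
    ≡⟨ cong (λ g → 1ℤ * g + rest) (γ-suc m) ⟩
      1ℤ * ((-1ℤ ^ suc m) - rest) + rest
    ≡⟨ cancel (-1ℤ ^ suc m) rest ⟩
      -1ℤ ^ suc m
    ∎
    where
    open ≡-Reasoning
    Fib : ℕ → ℤ
    Fib = fibPoly (suc (suc (suc m)))
    rest : ℤ
    rest = ∑< (suc m) (λ j → Fib (suc j) * γ (m ∸ j))
    cancel : ∀ a b → 1ℤ * (a - b) + b ≡ a
    cancel = ℤSolver.solve-∀

  Γcoeff-fibPoly-step : ∀ n m → Γcoeff (suc m) (fibPoly (suc (suc (suc (suc n))))) ≡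
                                Γcoeff (suc m) (fibPoly (suc (suc (suc n)))) + Γcoeff m (fibPoly (suc (suc n)))
  Γcoeff-fibPoly-step n m =
    trans (Γcoeff-+ (suc m) (fibPoly (suc (suc (suc n)))) (xmulℤ (fibPoly (suc (suc n)))))
          (cong (Γcoeff (suc m) (fibPoly (suc (suc (suc n)))) +_) (Γcoeff-xmul m (fibPoly (suc (suc n)))))

  Γcoeff-fibPoly-vanishes′ : ∀ e m → 1 ≤ m → e < m → Γcoeff m (fibPoly (suc (suc (m ℕ.+ suc e)))) ≡ 0ℤ
  Γcoeff-fibPoly-vanishes′ zero (suc m) _ _ =
    trans (cong (λ i → Γcoeff (suc m) (fibPoly (suc (suc (suc i))))) (ℕP.+-comm m 1))
    (trans (Γcoeff-fibPoly-step m m)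
    (trans (cong₂ _+_ (Γcoeff-fibPoly-diagonal (suc m)) (Γcoeff-fibPoly-diagonal m)) (alternate (-1ℤ ^ m))))
    where
    alternate : ∀ a → -1ℤ * a + a ≡ 0ℤ
    alternate = ℤSolver.solve-∀
  Γcoeff-fibPoly-vanishes′ (suc e) (suc m) 1≤1+m (s≤s e<m) =
    trans (cong (λ i → Γcoeff (suc m) (fibPoly (suc (suc (suc i))))) (ℕP.+-suc m (suc e)))
    (trans (Γcoeff-fibPoly-step (m ℕ.+ suc e) m)
      (cong₂ _+_ (Γcoeff-fibPoly-vanishes′ e (suc m) 1≤1+m (ℕP.m<n⇒m<1+n e<m))
                 (Γcoeff-fibPoly-vanishes′ e m (ℕP.≤-trans (s≤s z≤n) e<m) e<m)))

  Γcoeff-fibPoly-vanishes : ∀ n m → 1 ≤ m → m < n → n ≤ 2 ℕ.* m → Γcoeff m (fibPoly (suc (suc n))) ≡ 0ℤ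
  Γcoeff-fibPoly-vanishes n m 1≤m m<n n≤2m =
    subst (λ i → Γcoeff m (fibPoly (suc (suc i))) ≡ 0ℤ) m+[n-m]≡n
          (Γcoeff-fibPoly-vanishes′ (n ∸ suc m) m 1≤m n-m≤m)
    where
    m+[n-m]≡n : m ℕ.+ suc (n ∸ suc m) ≡ n
    m+[n-m]≡n = trans (ℕP.+-suc m (n ∸ suc m)) (ℕP.m+[n∸m]≡n m<n)
    n-m≤m : suc (n ∸ suc m) ≤ m
    n-m≤m = ℕP.+-cancelˡ-≤ m _ _
              (subst (_≤ m ℕ.+ m) (sym m+[n-m]≡n) (subst (n ≤_) (cong (m ℕ.+_) (ℕP.+-identityʳ m)) n≤2m))

  2m≤n⇒n≤2[n∸m] : ∀ m n → 2 ℕ.* m ≤ n → n ≤ 2 ℕ.* (n ∸ m)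
  2m≤n⇒n≤2[n∸m] m n 2m≤n =
    subst (n ≤_) (sym (ℕP.*-distribˡ-∸ 2 n m))
      (ℕP.m+n≤o⇒m≤o∸n n (subst (λ k → n ℕ.+ 2 ℕ.* m ≤ n ℕ.+ k) (sym (ℕP.+-identityʳ n)) (ℕP.+-monoʳ-≤ n 2m≤n)))

  Γcoeff-fibPoly-⋆ : ∀ d → 1 ≤ d → Γcoeff d (fibPoly d ⋆ fibPoly (suc (suc d))) ≡ -1ℤ ^ d
  Γcoeff-fibPoly-⋆ d@(suc d′) _ =
    trans (Γcoeff-⋆ d (fibPoly d) (fibPoly (suc (suc d))))
    (trans (∑<-head d (λ j → fibPoly d j * Ψ (d ∸ j)))
    (trans (cong₂ _+_ (trans (cong (_* Ψ d) (fibPoly-constant d′)) (trans (ℤP.*-identityˡ _) (Γcoeff-fibPoly-diagonal d)))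
                      (∑<-zero d (λ j j<d → term j j<d)))
     (ℤP.+-identityʳ _)))
    where
    Ψ : ℕ → ℤ
    Ψ m = Γcoeff m (fibPoly (suc (suc d)))
    term : ∀ j → j < d → fibPoly d (suc j) * Ψ (d ∸ suc j) ≡ 0ℤ
    term j j<d with ℕP.≤-<-connex d (2 ℕ.* suc j)
    ... | inj₁ d≤2[1+j] =
      trans (cong (_* Ψ (d ∸ suc j)) (fibPoly-degree d (suc j) d≤2[1+j])) (ℤP.*-zeroˡ (Ψ (d ∸ suc j)))
    ... | inj₂ 2[1+j]<d =
      trans (cong (fibPoly d (suc j) *_) (Γcoeff-fibPoly-vanishes d (d ∸ suc j) 1≤ d∸[1+j]<d d≤))
            (ℤP.*-zeroʳ (fibPoly d (suc j)))
      where
      1+j<d : suc j < d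
      1+j<d = ℕP.≤-<-trans (ℕP.m≤m+n (suc j) (suc j ℕ.+ 0)) 2[1+j]<d
      1≤ : 1 ≤ d ∸ suc j
      1≤ = ℕP.m<n⇒0<n∸m 1+j<d
      d∸[1+j]<d : d ∸ suc j < d
      d∸[1+j]<d = ℕP.∸-monoʳ-< {d} (s≤s z≤n) (ℕP.<⇒≤ 1+j<d)
      d≤ : d ≤ 2 ℕ.* (d ∸ suc j)
      d≤ = 2m≤n⇒n≤2[n∸m] (suc j) d (ℕP.<⇒≤ 2[1+j]<d)

module CountPolynomials where

  open import Data.Integer using (_+_; _*_; -_; _-_; _^_)
  open IntegerPolynomials
  open Counting using (shift)
  open LadderTilings

  binomialTerm : (ℕ → ℕ) → ℕ → ℕ → ℤ
  binomialTerm s j k = (ℤ.+ (s k ℕ.* (k C j))) * (-1ℤ ^ (k ∸ j))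

  -- The coefficient of x^j in Σ_{k<M} s k · (x - 1)^k, as in the definition of P.
  subXMinus1 : ℕ → (ℕ → ℕ) → ℕ → ℤ
  subXMinus1 M s j = ∑< M (binomialTerm s j)

  subXMinus1-cong : ∀ M s s′ → (∀ k → s k ≡ s′ k) → ∀ j → subXMinus1 M s j ≡ subXMinus1 M s′ j
  subXMinus1-cong M s s′ s≗s′ j =
    ∑<-cong M (λ k _ → cong (λ c → (ℤ.+ (c ℕ.* (k C j))) * (-1ℤ ^ (k ∸ j))) (s≗s′ k))

  subXMinus1-+ : ∀ M s s′ j → subXMinus1 M (λ k → s k ℕ.+ s′ k) j ≡ subXMinus1 M s j + subXMinus1 M s′ j
  subXMinus1-+ M s s′ j = trans (∑<-cong M (λ k _ →
      trans (cong (λ c → (ℤ.+ c) * (-1ℤ ^ (k ∸ j))) (ℕP.*-distribʳ-+ (k C j) (s k) (s′ k)))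
            (ℤP.*-distribʳ-+ (-1ℤ ^ (k ∸ j)) (ℤ.+ (s k ℕ.* (k C j))) (ℤ.+ (s′ k ℕ.* (k C j))))))
    (∑<-+ M _ _)

  binomialTerm-zero : ∀ s j k → s k ≡ 0 → binomialTerm s j k ≡ 0ℤ
  binomialTerm-zero s j k sk≡0 rewrite sk≡0 = ℤP.*-zeroˡ (-1ℤ ^ (k ∸ j))

  subXMinus1-δ₀ : ∀ M j → subXMinus1 (suc M) δ₀ j ≡ oneℤ j
  subXMinus1-δ₀ zero    zero    = refl
  subXMinus1-δ₀ zero    (suc j) = refl
  subXMinus1-δ₀ (suc M) j =
    trans (cong (subXMinus1 (suc M) δ₀ j +_) (binomialTerm-zero δ₀ j (suc M) refl))
          (trans (ℤP.+-identityʳ _) (subXMinus1-δ₀ M j))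

  binomialTerm-shift-zero : ∀ s k → binomialTerm (shift s) 0 (suc k) ≡ - binomialTerm s 0 k
  binomialTerm-shift-zero s k = negate (ℤ.+ (s k ℕ.* 1)) (-1ℤ ^ k)
    where
    negate : ∀ a b → a * (-1ℤ * b) ≡ - (a * b)
    negate = ℤSolver.solve-∀

  binomialTerm-shift : ∀ s j k → binomialTerm (shift s) (suc j) (suc k) ≡ binomialTerm s j k - binomialTerm s (suc j) k
  binomialTerm-shift s j k = begin
      ℤ.+ (s k ℕ.* (suc k C suc j)) * sign
    ≡⟨ cong (λ c → ℤ.+ (s k ℕ.* c) * sign) (nCk+nC[k+1]≡[n+1]C[k+1] k j) ⟨
      ℤ.+ (s k ℕ.* (k C j ℕ.+ k C suc j)) * sign
    ≡⟨ cong (λ c → ℤ.+ c * sign) (ℕP.*-distribˡ-+ (s k) (k C j) (k C suc j)) ⟩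
      (ℤ.+ (s k ℕ.* (k C j)) + ℤ.+ (s k ℕ.* (k C suc j))) * sign
    ≡⟨ ℤP.*-distribʳ-+ sign (ℤ.+ (s k ℕ.* (k C j))) (ℤ.+ (s k ℕ.* (k C suc j))) ⟩
      binomialTerm s j k + ℤ.+ (s k ℕ.* (k C suc j)) * sign
    ≡⟨ cong (binomialTerm s j k +_) (sign-flip (s k)) ⟩
      binomialTerm s j k - binomialTerm s (suc j) k
    ∎
    where
    open ≡-Reasoning
    sign : ℤ
    sign = -1ℤ ^ (k ∸ j)
    sign-flip : ∀ c → ℤ.+ (c ℕ.* (k C suc j)) * sign ≡ - (ℤ.+ (c ℕ.* (k C suc j)) * (-1ℤ ^ (k ∸ suc j)))
    sign-flip c with ℕP.<-≤-connex j k
    ... | inj₁ j<k rewrite ℕP.+-∸-assoc 1 j<k = negate (ℤ.+ (c ℕ.* (k C suc j))) (-1ℤ ^ (k ∸ suc j))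
      where
      negate : ∀ a b → a * (-1ℤ * b) ≡ - (a * b)
      negate = ℤSolver.solve-∀
    ... | inj₂ k≤j rewrite k>n⇒nCk≡0 {k} {suc j} (s≤s k≤j) | ℕP.*-zeroʳ c = refl

  subXMinus1-shift : ∀ M s j → subXMinus1 (suc M) (shift s) j ≡ xmulℤ (subXMinus1 M s) j - subXMinus1 M s j
  subXMinus1-shift M s j =
    trans (∑<-head M (binomialTerm (shift s) j))
    (trans (cong (_+ ∑< M (λ k → binomialTerm (shift s) j (suc k))) (ℤP.*-zeroˡ (-1ℤ ^ (0 ∸ j))))
    (trans (ℤP.+-identityˡ _) (shifted j)))
    where
    shifted : ∀ j → ∑< M (λ k → binomialTerm (shift s) j (suc k)) ≡ xmulℤ (subXMinus1 M s) j - subXMinus1 M s j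
    shifted zero    = trans (∑<-cong M (λ k _ → binomialTerm-shift-zero s k))
                        (trans (∑<-neg M (binomialTerm s 0)) (sym (ℤP.+-identityˡ _)))
    shifted (suc j) = trans (∑<-cong M (λ k _ → binomialTerm-shift s j k)) (∑<-- M _ _)

  subXMinus1-plus-shift : ∀ M g (p : ℕ → ℤ) →
                          (∀ j → subXMinus1 M g j ≡ p j) → (∀ j → subXMinus1 (suc M) g j ≡ p j) →
                          ∀ j → subXMinus1 (suc M) (λ k → g k ℕ.+ shift g k) j ≡ xmulℤ p j
  subXMinus1-plus-shift M g p g↦p g↦p′ j = begin
      subXMinus1 (suc M) (λ k → g k ℕ.+ shift g k) j
    ≡⟨ subXMinus1-+ (suc M) g (shift g) j ⟩
      subXMinus1 (suc M) g j + subXMinus1 (suc M) (shift g) j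
    ≡⟨ cong₂ _+_ (g↦p′ j) (subXMinus1-shift M g j) ⟩
      p j + (xmulℤ (subXMinus1 M g) j - subXMinus1 M g j)
    ≡⟨ cong₂ (λ a b → p j + (a - b)) (xmulℤ-cong _ _ g↦p j) (g↦p j) ⟩
      p j + (xmulℤ p j - p j)
    ≡⟨ cancel (p j) (xmulℤ p j) ⟩
      xmulℤ p j
    ∎
    where
    open ≡-Reasoning
    cancel : ∀ a b → a + (b - a) ≡ b
    cancel = ℤSolver.solve-∀

  oneℤ≗fibPoly₂ : ∀ j → oneℤ j ≡ fibPoly 2 j
  oneℤ≗fibPoly₂ zero    = refl
  oneℤ≗fibPoly₂ (suc j) = refl

  subXMinus1-notched-farTile : ∀ n M j → n < M → subXMinus1 M (notched farTile n) j ≡ fibPoly (suc (suc n)) j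
  subXMinus1-notched⁺-farTile : ∀ n M j → suc n < M → subXMinus1 M (notched⁺ farTile n) j ≡ xmulℤ (fibPoly (suc n)) j

  subXMinus1-notched-farTile zero (suc M) j _ =
    trans (subXMinus1-cong (suc M) (notched farTile 0) δ₀ notched-farTile-zero j)
          (trans (subXMinus1-δ₀ M j) (oneℤ≗fibPoly₂ j))
  subXMinus1-notched-farTile (suc n) M j 1+n<M =
    trans (subXMinus1-cong M _ _ (notched-farTile-suc n) j)
    (trans (subXMinus1-+ M (notched⁺ farTile n) (notched farTile n) j)
    (trans (cong₂ _+_ (subXMinus1-notched⁺-farTile n M j 1+n<M)
                      (subXMinus1-notched-farTile n M j (ℕP.<-trans (ℕP.n<1+n n) 1+n<M)))
     (ℤP.+-comm (xmulℤ (fibPoly (suc n)) j) (fibPoly (suc (suc n)) j))))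

  subXMinus1-notched⁺-farTile zero (suc zero) j (s≤s ())
  subXMinus1-notched⁺-farTile zero (suc (suc M)) j _ =
    trans (subXMinus1-cong (suc (suc M)) _ _ notched⁺-farTile-zero j)
          (subXMinus1-plus-shift (suc M) δ₀ oneℤ (subXMinus1-δ₀ M) (subXMinus1-δ₀ (suc M)) j)
  subXMinus1-notched⁺-farTile (suc n) (suc M) j (s≤s 1+n<M) =
    trans (subXMinus1-cong (suc M) _ _ (notched⁺-farTile-suc n) j)
          (subXMinus1-plus-shift M (notched farTile n) (fibPoly (suc (suc n)))
            (λ j → subXMinus1-notched-farTile n M j (ℕP.<-trans (ℕP.n<1+n n) 1+n<M))
            (λ j → subXMinus1-notched-farTile n (suc M) j (ℕP.m<n⇒m<1+n (ℕP.<-trans (ℕP.n<1+n n) 1+n<M))) j)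

  subXMinus1-leftOfSlot : ∀ i M j → i < M → subXMinus1 M (leftOfSlot i) j ≡ fibPoly (suc i) j
  subXMinus1-leftOfSlot zero    (suc M) j _   = subXMinus1-δ₀ M j
  subXMinus1-leftOfSlot (suc m) M       j m<M = subXMinus1-notched-farTile m M j (ℕP.<-trans (ℕP.n<1+n m) m<M)

  module SlotPolynomials (i : ℕ) where

    L : ℕ → ℤ
    L = fibPoly (suc i)

    H H⁺ : ℕ → ℕ → ℕ
    H  m = notched  (slot i) (suc i ℕ.+ m)
    H⁺ m = notched⁺ (slot i) (suc i ℕ.+ m)

    H-zero : ∀ k → H 0 k ≡ leftOfSlot i k
    H-zero k = trans (cong (λ c → notched (slot i) c k) (ℕP.+-identityʳ (suc i))) (notched-slot-base i k)

    H⁺-zero : ∀ k → H⁺ 0 k ≡ 0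
    H⁺-zero k = trans (cong (λ c → notched⁺ (slot i) c k) (ℕP.+-identityʳ (suc i))) (notched⁺-slot-base i k)

    H-suc : ∀ m k → H (suc m) k ≡ H⁺ m k ℕ.+ H m k
    H-suc m k = trans (cong (λ c → notched (slot i) c k) (ℕP.+-suc (suc i) m))
                      (notched-suc (slot i) (suc i) (slot-columnsAtMost i) (suc i ℕ.+ m) (ℕP.m≤m+n (suc i) m) k)

    H⁺-suc : ∀ m k → H⁺ (suc m) k ≡ H m k ℕ.+ shift (H m) k
    H⁺-suc m k = trans (cong (λ c → notched⁺ (slot i) c k) (ℕP.+-suc (suc i) m))
                       (notched⁺-suc (slot i) (suc i) (slot-columnsAtMost i) (suc i ℕ.+ m) (ℕP.m≤m+n (suc i) m) k)

    subXMinus1-H : ∀ m M j → suc i ℕ.+ m < M → subXMinus1 M (H m) j ≡ (L ⋆ fibPoly (suc m)) j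
    subXMinus1-H⁺ : ∀ m M j → suc (suc i ℕ.+ m) < M → subXMinus1 M (H⁺ m) j ≡ xmulℤ (L ⋆ fibPoly m) j

    subXMinus1-H zero M j i<M =
      trans (subXMinus1-cong M (H 0) (leftOfSlot i) H-zero j)
      (trans (subXMinus1-leftOfSlot i M j (ℕP.<-trans (ℕP.n<1+n i) (subst (_< M) (ℕP.+-identityʳ (suc i)) i<M)))
       (sym (⋆-identityʳ L j)))
    subXMinus1-H (suc m) M j i+m<M =
      trans (subXMinus1-cong M _ _ (H-suc m) j)
      (trans (subXMinus1-+ M (H⁺ m) (H m) j)
      (trans (cong₂ _+_ (subXMinus1-H⁺ m M j i+m<M′) (subXMinus1-H m M j (ℕP.<-trans (ℕP.n<1+n _) i+m<M′)))
      (trans (ℤP.+-comm (xmulℤ (L ⋆ fibPoly m) j) ((L ⋆ fibPoly (suc m)) j))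
       (sym (trans (⋆-distribˡ-+ L (fibPoly (suc m)) (xmulℤ (fibPoly m)) j)
                   (cong ((L ⋆ fibPoly (suc m)) j +_) (⋆-xmulʳ L (fibPoly m) j)))))))
      where
      i+m<M′ : suc (suc i ℕ.+ m) < M
      i+m<M′ = subst (_< M) (ℕP.+-suc (suc i) m) i+m<M

    subXMinus1-H⁺ zero M j _ =
      trans (subXMinus1-cong M (H⁺ 0) (λ _ → 0) H⁺-zero j)
      (trans (∑<-zero M (λ k _ → binomialTerm-zero (λ _ → 0) j k refl)) (sym (xmul⋆zero j)))
      where
      xmul⋆zero : ∀ j → xmulℤ (L ⋆ fibPoly 0) j ≡ 0ℤ
      xmul⋆zero zero    = refl
      xmul⋆zero (suc j) = ⋆-zeroʳ L j
    subXMinus1-H⁺ (suc m) (suc M) j i+m<M =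
      trans (subXMinus1-cong (suc M) _ _ (H⁺-suc m) j)
            (subXMinus1-plus-shift M (H m) (L ⋆ fibPoly (suc m))
              (λ j → subXMinus1-H m M j (ℕP.<-trans (ℕP.n<1+n _) i+m<M′))
              (λ j → subXMinus1-H m (suc M) j (ℕP.m<n⇒m<1+n (ℕP.<-trans (ℕP.n<1+n _) i+m<M′))) j)
      where
      i+m<M′ : suc (suc i ℕ.+ m) < M
      i+m<M′ = ℕP.≤-pred (subst (λ c → suc c < suc M) (ℕP.+-suc (suc i) m) i+m<M)

  subXMinus1-ladder : ∀ i m M j → suc (suc (suc i ℕ.+ m)) < M →
    subXMinus1 M (f (ladder (suc i ℕ.+ m) (suc i))) j
      ≡ fibPoly (suc (suc (suc i ℕ.+ m))) j + xmulℤ (fibPoly (suc i) ⋆ fibPoly (suc m)) j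
  subXMinus1-ladder i m (suc M) j n+2<M =
    trans (subXMinus1-cong (suc M) _ (λ k → notched farTile n k ℕ.+ (H m k ℕ.+ shift (H m) k))
             (λ k → trans (LadderRegion.f-ladder n i (ℕP.m≤m+n (suc i) m) k)
                          (cong (notched farTile n k ℕ.+_) (ℕP.+-comm (shift (H m) k) (H m k)))) j)
    (trans (subXMinus1-+ (suc M) (notched farTile n) (λ k → H m k ℕ.+ shift (H m) k) j)
      (cong₂ _+_ (subXMinus1-notched-farTile n (suc M) j (ℕP.m<n⇒m<1+n n<M))
                 (subXMinus1-plus-shift M (H m) (fibPoly (suc i) ⋆ fibPoly (suc m))
                   (λ j → subXMinus1-H m M j n<M) (λ j → subXMinus1-H m (suc M) j (ℕP.m<n⇒m<1+n n<M)) j)))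
    where
    open SlotPolynomials i
    n : ℕ
    n = suc i ℕ.+ m
    n<M : n < M
    n<M = ℕP.<-trans (ℕP.n<1+n n) (ℕP.≤-pred n+2<M)

module RationalFunctional where

  open import Data.Rational using (_+_; _*_; _-_)
  open IntegerPolynomials using (xmulℤ; fibPoly; _⋆_; γ; Γcoeff; Γcoeff-xmul; Γcoeff-+;
                                 Γcoeff-fibPoly-vanishes; Γcoeff-fibPoly-⋆)
  open CountPolynomials using (subXMinus1; subXMinus1-cong; subXMinus1-notched-farTile; subXMinus1-ladder)
  open LadderTilings using (f≡notched-farTile; notched; farTile)
  open FiniteSums ℚP.+-*-commutativeRing
  open import Algebra.Properties.Ring (CommutativeRing.ring ℚP.+-*-commutativeRing) using (x[y-z]≈xy-xz)
  module ℤΣ = FiniteSums ℤP.+-*-commutativeRing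

  toℚᵘ-ℤtoℚ : ∀ z → toℚᵘ (ℤtoℚ z) ℚᵘ.≃ mkℚᵘ z 0
  toℚᵘ-ℤtoℚ z = ℚP.toℚᵘ-fromℚᵘ (mkℚᵘ z 0)

  ℤtoℚ-+ : ∀ a b → ℤtoℚ (a ℤ.+ b) ≡ ℤtoℚ a + ℤtoℚ b
  ℤtoℚ-+ a b = ℚP.toℚᵘ-injective
    (ℚᵘP.≃-trans (toℚᵘ-ℤtoℚ (a ℤ.+ b))
    (ℚᵘP.≃-trans (*≡* (over-one a b))
     (ℚᵘP.≃-sym (ℚᵘP.≃-trans (ℚP.toℚᵘ-homo-+ (ℤtoℚ a) (ℤtoℚ b))
                             (ℚᵘP.+-cong (toℚᵘ-ℤtoℚ a) (toℚᵘ-ℤtoℚ b))))))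
    where
    over-one : ∀ a b → (a ℤ.+ b) ℤ.* 1ℤ ≡ (a ℤ.* 1ℤ ℤ.+ b ℤ.* 1ℤ) ℤ.* 1ℤ
    over-one = ℤSolver.solve-∀

  ℤtoℚ-* : ∀ a b → ℤtoℚ (a ℤ.* b) ≡ ℤtoℚ a * ℤtoℚ b
  ℤtoℚ-* a b = ℚP.toℚᵘ-injective
    (ℚᵘP.≃-trans (toℚᵘ-ℤtoℚ (a ℤ.* b))
    (ℚᵘP.≃-trans (*≡* refl)
     (ℚᵘP.≃-sym (ℚᵘP.≃-trans (ℚP.toℚᵘ-homo-* (ℤtoℚ a) (ℤtoℚ b))
                             (ℚᵘP.*-cong (toℚᵘ-ℤtoℚ a) (toℚᵘ-ℤtoℚ b))))))

  ℤtoℚ-∑< : ∀ n (h : ℕ → ℤ) → ∑< n (ℤtoℚ ∘ h) ≡ ℤtoℚ (ℤΣ.∑< n h)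
  ℤtoℚ-∑< zero    h = refl
  ℤtoℚ-∑< (suc n) h = trans (cong (_+ ℤtoℚ (h n)) (ℤtoℚ-∑< n h)) (sym (ℤtoℚ-+ (ℤΣ.∑< n h) (h n)))

  sumBelow≡∑< : ∀ n g → sumBelow n g ≡ ∑< n g
  sumBelow≡∑< zero    g = refl
  sumBelow≡∑< (suc n) g = cong (_+ g n) (sumBelow≡∑< n g)

  P≡subXMinus1 : ∀ R j → P R j ≡ ℤtoℚ (subXMinus1 (suc (length R)) (f R) j)
  P≡subXMinus1 R j = trans (sumBelow≡∑< (suc (length R)) _) (ℤtoℚ-∑< (suc (length R)) _)

  length-++-pair : ∀ (xs : List Cell) a b → length (xs ++ a ∷ b ∷ []) ≡ 2 ℕ.+ length xs
  length-++-pair xs a b = trans (length-++ xs) (ℕP.+-comm (length xs) 2)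

  n<length-rect : ∀ n → n < length (rect n)
  n<length-rect zero    = s≤s z≤n
  n<length-rect (suc n) =
    subst (suc n <_) (sym (length-++-pair (rect n) _ _)) (ℕP.≤-trans (s≤s (n<length-rect n)) (ℕP.n≤1+n _))

  Pn≡fibPoly : ∀ n j → Pn n j ≡ ℤtoℚ (fibPoly (suc (suc n)) j)
  Pn≡fibPoly n j =
    trans (P≡subXMinus1 (rect n) j)
      (cong ℤtoℚ (trans (subXMinus1-cong (suc (length (rect n))) _ _ (f≡notched-farTile n) j)
                        (subXMinus1-notched-farTile n (suc (length (rect n))) j
                          (ℕP.m<n⇒m<1+n (n<length-rect n)))))

  Pni≡fibPoly : ∀ i m j → P (ladder (suc i ℕ.+ m) (suc i)) j ≡
    ℤtoℚ (fibPoly (suc (suc (suc i ℕ.+ m))) j ℤ.+ xmulℤ (fibPoly (suc i) ⋆ fibPoly (suc m)) j)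
  Pni≡fibPoly i m j =
    trans (P≡subXMinus1 (ladder n (suc i)) j)
          (cong ℤtoℚ (subXMinus1-ladder i m (suc (length (ladder n (suc i)))) j n+2<))
    where
    n : ℕ
    n = suc i ℕ.+ m
    n+2< : suc (suc n) < suc (length (ladder n (suc i)))
    n+2< = subst (λ l → suc (suc n) < suc l) (sym (length-++-pair (rect n) _ _))
             (s≤s (s≤s (s≤s (ℕP.<⇒≤ (n<length-rect n)))))

  -- ϕ d p is the coefficient of x^(d+1) in p·Γ, for p of degree at most d + 1.
  ϕ : ℕ → Poly → ℚ
  ϕ d p = ∑< (suc (suc d)) (λ j → ℤtoℚ (γ (suc d ∸ j)) * p j)

  ϕ-cong : ∀ d p q → (∀ j → p j ≡ q j) → ϕ d p ≡ ϕ d q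
  ϕ-cong d p q p≗q = ∑<-cong (suc (suc d)) (λ j _ → cong (ℤtoℚ (γ (suc d ∸ j)) *_) (p≗q j))

  ϕ-ℤtoℚ : ∀ d q → ϕ d (ℤtoℚ ∘ q) ≡ ℤtoℚ (Γcoeff (suc d) q)
  ϕ-ℤtoℚ d q =
    trans (∑<-cong (suc (suc d)) (λ j _ →
             trans (sym (ℤtoℚ-* (γ (suc d ∸ j)) (q j))) (cong ℤtoℚ (ℤP.*-comm (γ (suc d ∸ j)) (q j)))))
          (ℤtoℚ-∑< (suc (suc d)) (λ j → q j ℤ.* γ (suc d ∸ j)))

  ϕ-xmul : ∀ d p → ϕ (suc d) (xmul p) ≡ ϕ d p
  ϕ-xmul d p =
    trans (∑<-head (suc (suc d)) (λ j → ℤtoℚ (γ (suc (suc d) ∸ j)) * xmul p j))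
    (trans (cong (_+ ϕ d p) (ℚP.*-zeroʳ (ℤtoℚ (γ (suc (suc d)))))) (ℚP.+-identityˡ (ϕ d p)))

  ϕ-- : ∀ d p q → ϕ d (λ j → p j - q j) ≡ ϕ d p - ϕ d q
  ϕ-- d p q =
    trans (∑<-cong (suc (suc d)) (λ j _ → x[y-z]≈xy-xz (ℤtoℚ (γ (suc d ∸ j))) (p j) (q j))) (∑<-- (suc (suc d)) _ _)

  ϕ-∑< : ∀ d m (c : ℕ → ℚ) (q : ℕ → Poly) →
         ϕ d (λ j → ∑< m (λ k → c k * q k j)) ≡ ∑< m (λ k → c k * ϕ d (q k))
  ϕ-∑< d m c q =
    trans (∑<-cong (suc (suc d)) (λ j _ → sym (∑<-*ˡ m (γ̂ j) _)))
    (trans (∑<-swap (suc (suc d)) m (λ j k → γ̂ j * (c k * q k j)))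
     (∑<-cong m (λ k _ → trans (∑<-cong (suc (suc d)) (λ j _ → swap-left (γ̂ j) (c k) (q k j)))
                                (∑<-*ˡ (suc (suc d)) (c k) _))))
    where
    γ̂ : ℕ → ℚ
    γ̂ j = ℤtoℚ (γ (suc d ∸ j))
    swap-left : ∀ x y z → x * (y * z) ≡ y * (x * z)
    swap-left x y z = trans (sym (ℚP.*-assoc x y z)) (trans (cong (_* z) (ℚP.*-comm x y)) (ℚP.*-assoc y x z))

  ϕ-Pn-vanishes : ∀ d → ϕ (suc d) (Pn (suc (suc (suc (d ℕ.+ d))))) ≡ 0ℚ
  ϕ-Pn-vanishes d =
    trans (ϕ-cong (suc d) _ (ℤtoℚ ∘ fibPoly (suc (suc N))) (Pn≡fibPoly N))
    (trans (ϕ-ℤtoℚ (suc d) (fibPoly (suc (suc N))))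
     (cong ℤtoℚ (Γcoeff-fibPoly-vanishes N (suc (suc d)) (s≤s z≤n) (s≤s (s≤s (s≤s (ℕP.m≤m+n d d)))) N≤)))
    where
    N : ℕ
    N = suc (suc (suc (d ℕ.+ d)))
    N≤ : N ≤ 2 ℕ.* suc (suc d)
    N≤ = ℕP.≤-trans (ℕP.n≤1+n N) (ℕP.≤-reflexive (2+2d≡ d))
      where
      2+2d≡ : ∀ d → suc (suc (suc (suc (d ℕ.+ d)))) ≡ 2 ℕ.* suc (suc d)
      2+2d≡ = ℕSolver.solve-∀

  ϕ-img : ∀ d k → ϕ d (img d k) ≡ 0ℚ
  ϕ-img zero    zero    = refl
  ϕ-img zero    (suc k) = ∑<-zero 2 (λ j _ → ℚP.*-zeroʳ (ℤtoℚ (γ (1 ∸ j))))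
  ϕ-img (suc d) (suc k) = trans (ϕ-xmul d (img d k)) (ϕ-img d k)
  ϕ-img (suc d) zero    = begin
      ϕ (suc d) (img (suc d) zero)
    ≡⟨ ϕ-cong (suc d) _ _ (λ j → cong (Pn N j -_) (sumBelow≡∑< (suc d) (λ k → c k * xmul (img d k) j))) ⟩
      ϕ (suc d) (λ j → Pn N j - ∑< (suc d) (λ k → c k * xmul (img d k) j))
    ≡⟨ ϕ-- (suc d) (Pn N) _ ⟩
      ϕ (suc d) (Pn N) - ϕ (suc d) (λ j → ∑< (suc d) (λ k → c k * xmul (img d k) j))
    ≡⟨ cong₂ _-_ (ϕ-Pn-vanishes d) (ϕ-∑< (suc d) (suc d) c (λ k → xmul (img d k))) ⟩
      0ℚ - ∑< (suc d) (λ k → c k * ϕ (suc d) (xmul (img d k)))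
    ≡⟨ cong (0ℚ -_) (∑<-zero (suc d) (λ k _ → trans (cong (c k *_) (trans (ϕ-xmul d (img d k)) (ϕ-img d k)))
                                                       (ℚP.*-zeroʳ (c k)))) ⟩
      0ℚ
    ∎
    where
    open ≡-Reasoning
    N : ℕ
    N = suc (suc (suc (d ℕ.+ d)))
    c : ℕ → ℚ
    c k = Pn (suc (d ℕ.+ d)) (suc k)

  ϕ-A : ∀ d q → ϕ d (A d q) ≡ 0ℚ
  ϕ-A d q =
    trans (ϕ-cong d (A d q) _ (λ j → sumBelow≡∑< (suc d) (λ k → q k * img d k j)))
    (trans (ϕ-∑< d (suc d) q (img d))
     (∑<-zero (suc d) (λ k _ → trans (cong (q k *_) (ϕ-img d k)) (ℚP.*-zeroʳ (q k)))))

  Pni-diagonal≡fibPoly : ∀ d′ j → let d = suc d′ ; n = 1 ℕ.+ (d ℕ.+ d) in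
    Pni n d j ≡ ℤtoℚ (fibPoly (suc (suc n)) j ℤ.+ xmulℤ (fibPoly d ⋆ fibPoly (suc (suc d))) j)
  Pni-diagonal≡fibPoly d′ j =
    subst (λ n → P (ladder n (suc d′)) j ≡
                 ℤtoℚ (fibPoly (suc (suc n)) j ℤ.+ xmulℤ (fibPoly (suc d′) ⋆ fibPoly (suc (suc (suc d′)))) j))
          (split d′) (Pni≡fibPoly d′ (suc (suc d′)) j)
    where
    split : ∀ d′ → suc d′ ℕ.+ suc (suc d′) ≡ 1 ℕ.+ (suc d′ ℕ.+ suc d′)
    split = ℕSolver.solve-∀

  ϕ-Pni : ∀ d → 1 ≤ d → ϕ d (Pni (1 ℕ.+ (d ℕ.+ d)) d) ≡ ℤtoℚ (-1ℤ ℤ.^ d)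
  ϕ-Pni d@(suc d′) _ = begin
      ϕ d (Pni n d)
    ≡⟨ ϕ-cong d _ (ℤtoℚ ∘ T) (Pni-diagonal≡fibPoly d′) ⟩
      ϕ d (ℤtoℚ ∘ T)
    ≡⟨ ϕ-ℤtoℚ d T ⟩
      ℤtoℚ (Γcoeff (suc d) T)
    ≡⟨ cong ℤtoℚ (Γcoeff-+ (suc d) (fibPoly (suc (suc n))) (xmulℤ F⋆F)) ⟩
      ℤtoℚ (Γcoeff (suc d) (fibPoly (suc (suc n))) ℤ.+ Γcoeff (suc d) (xmulℤ F⋆F))
    ≡⟨ cong ℤtoℚ (cong₂ ℤ._+_ (Γcoeff-fibPoly-vanishes n (suc d) (s≤s z≤n) 1+d<n n≤2+2d)
                              (Γcoeff-xmul d F⋆F)) ⟩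
      ℤtoℚ (0ℤ ℤ.+ Γcoeff d F⋆F)
    ≡⟨ cong ℤtoℚ (trans (ℤP.+-identityˡ _) (Γcoeff-fibPoly-⋆ d (s≤s z≤n))) ⟩
      ℤtoℚ (-1ℤ ℤ.^ d)
    ∎
    where
    open ≡-Reasoning
    n : ℕ
    n = 1 ℕ.+ (d ℕ.+ d)
    F⋆F : ℕ → ℤ
    F⋆F = fibPoly d ⋆ fibPoly (suc (suc d))
    T : ℕ → ℤ
    T j = fibPoly (suc (suc n)) j ℤ.+ xmulℤ F⋆F j
    1+d<n : suc d < n
    1+d<n = s≤s (ℕP.≤-trans (ℕP.≤-reflexive (ℕP.+-comm 1 d)) (ℕP.+-monoʳ-≤ d (s≤s z≤n)))
    n≤2+2d : n ≤ 2 ℕ.* suc d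
    n≤2+2d = ℕP.≤-trans (ℕP.n≤1+n n) (ℕP.≤-reflexive (2+2d≡ d))
      where
      2+2d≡ : ∀ d → suc (1 ℕ.+ (d ℕ.+ d)) ≡ 2 ℕ.* suc d
      2+2d≡ = ℕSolver.solve-∀

  -1^≡±1 : ∀ d → (-1ℤ ℤ.^ d ≡ 1ℤ) ⊎ (-1ℤ ℤ.^ d ≡ -1ℤ)
  -1^≡±1 zero = inj₁ refl
  -1^≡±1 (suc d) with -1^≡±1 d
  ... | inj₁ e rewrite e = inj₂ refl
  ... | inj₂ e rewrite e = inj₁ refl

  ℤtoℚ-sign≢0 : ∀ d → ℤtoℚ (-1ℤ ℤ.^ d) ≢ 0ℚ
  ℤtoℚ-sign≢0 d with -1^≡±1 d
  ... | inj₁ e rewrite e = λ ()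
  ... | inj₂ e rewrite e = λ ()

lemma4p8 : (d : ℕ) → 1 ≤ d → ¬ InAdF d (Pni (1 ℕ.+ (d ℕ.+ d)) d)
lemma4p8 d 1≤d (q , _ , Aq≗Pni) = ℤtoℚ-sign≢0 d (begin
    ℤtoℚ (-1ℤ ℤ.^ d)                 ≡⟨ ϕ-Pni d 1≤d ⟨
    ϕ d (Pni (1 ℕ.+ (d ℕ.+ d)) d)   ≡⟨ ϕ-cong d _ _ Aq≗Pni ⟨
    ϕ d (A d q)                      ≡⟨ ϕ-A d q ⟩
    0ℚ                               ∎)
  where
  open RationalFunctional
  open ≡-Reasoning
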